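{- Let $V(\mathcal{I})$ and $\Delta(\mathcal{I})$ denote the vertex set and maximum degree of the interference graph $\mathcal{I}(G,l)$. Then (i) $|V(\mathcal{I})|=nd(d-1)^{l-1}/2$; (ii) $\Delta(\mathcal{I})\le(l+1)^2d(d-1)^{l-1}$. Furthermore, the number of rooted $\lambda$-vertex trees contained in $\mathcal{I}$ is at most $4^\lambda\cdot|V(\mathcal{I})|\cdot\Delta(\mathcal{I})^{\lambda-1}$.
   Context: $G$ is a $d$-regular graph on $n$ vertices with $d=\omega(\log n)$, $l$ is an integer with $l=\omega(1)$, $l=o(\log_d n)$, and $G$ has girth at least $10\,l\log\log n$. An $l$-walk is a path of length $l$ in $G$ (the vertex sequence of a non-backtracking walk of length $l$), identified with its vertex set, considered without orientation. The interference graph $\mathcal{I}(G,l)$ has as vertices all $l$-walks of $G$, two being adjacent iff they share a vertex. -}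

module Defs where

open import Data.Bool using (Bool; true; false; _∧_; _∨_; not; T)
import Data.Bool.Properties as BoolP
open import Data.Nat using (ℕ; zero; suc; _+_; _*_; _∸_; _⊔_; _≡ᵇ_)
open import Data.Fin using (Fin) renaming (_≟_ to _≟ᶠ_)
open import Data.Fin.Subset using (Subset; ⁅_⁆; _∪_; _∩_; ∣_∣)
open import Data.Vec using (Vec; []; _∷_; lookup; tabulate; allFin)
import Data.Vec as Vec
open import Data.Vec.Properties using (≡-dec)
open import Data.List using (List; []; _∷_; map; concatMap; filterᵇ; length)
open import Data.Bool.ListAction using (any)
open import Data.Product using (_×_; _,_)
open import Relation.Binary.PropositionalEquality using (_≡_)
open import Relation.Nullary.Decidable using (⌊_⌋)

Graph : ℕ → Set
Graph n = Fin n → Fin n → Bool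

IsSimple : ∀ {n} → Graph n → Set
IsSimple {n} G = (∀ (i j : Fin n) → G i j ≡ G j i) × (∀ (i : Fin n) → G i i ≡ false)

degree : ∀ {n} → Graph n → Fin n → ℕ
degree G i = ∣ tabulate (G i) ∣

Regular : ∀ {n} → ℕ → Graph n → Set
Regular {n} d G = ∀ (i : Fin n) → degree G i ≡ d

maxDegree : ∀ {n} → Graph n → ℕ
maxDegree {n} G = Vec.foldr (λ _ → ℕ) (λ i m → degree G i ⊔ m) 0 (allFin n)

memᵇ : ∀ {n m} → Fin n → Vec (Fin n) m → Bool
memᵇ x []       = false
memᵇ x (y ∷ ys) = ⌊ x ≟ᶠ y ⌋ ∨ memᵇ x ys

allDistinct : ∀ {n m} → Vec (Fin n) m → Bool
allDistinct []       = true
allDistinct (x ∷ xs) = not (memᵇ x xs) ∧ allDistinct xs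

consecAdj : ∀ {n m} → Graph n → Vec (Fin n) m → Bool
consecAdj G []           = true
consecAdj G (x ∷ [])     = true
consecAdj G (x ∷ y ∷ xs) = G x y ∧ consecAdj G (y ∷ xs)

lastV : ∀ {n m} → Vec (Fin n) (suc m) → Fin n
lastV (x ∷ [])     = x
lastV (x ∷ y ∷ xs) = lastV (y ∷ xs)

isPath : ∀ {n m} → Graph n → Vec (Fin n) m → Bool
isPath G vs = allDistinct vs ∧ consecAdj G vs

isCycle : ∀ {n k} → Graph n → Vec (Fin n) k → Bool
isCycle G []         = false
isCycle G (x ∷ xs)   = isPath G (x ∷ xs) ∧ G (lastV (x ∷ xs)) x

Girth≥ : ∀ {n} → Graph n → ℕ → Set
Girth≥ {n} G g = ∀ (k : ℕ) → 3 Data.Nat.≤ k → k Data.Nat.< g →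
                 ∀ (vs : Vec (Fin n) k) → isCycle G vs ≡ false

allVecs : (n m : ℕ) → List (Vec (Fin n) m)
allVecs n zero    = [] ∷ []
allVecs n (suc m) = concatMap (λ x → map (x ∷_) (allVecs n m)) (Data.List.allFin n)

allSubsets : (n : ℕ) → List (Subset n)
allSubsets zero    = [] ∷ []
allSubsets (suc n) = concatMap (λ b → map (b ∷_) (allSubsets n)) (true ∷ false ∷ [])

allVecsOf : ∀ {A : Set} → List A → (m : ℕ) → List (Vec A m)
allVecsOf xs zero    = [] ∷ []
allVecsOf xs (suc m) = concatMap (λ x → map (x ∷_) (allVecsOf xs m)) xs

subsetEqᵇ : ∀ {n} → Subset n → Subset n → Bool
subsetEqᵇ S T = ⌊ ≡-dec BoolP._≟_ S T ⌋

nonemptyᵇ : ∀ {n} → Subset n → Bool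
nonemptyᵇ S = Vec.foldr (λ _ → Bool) _∨_ false S

vset : ∀ {n m} → Vec (Fin n) m → Subset n
vset {n} vs = Vec.foldr (λ _ → Subset n) (λ x s → ⁅ x ⁆ ∪ s) (Vec.replicate _ false) vs

-- l-walks: vertex sets of paths of length l (l+1 vertices), unoriented

isLWalk : ∀ {n} → Graph n → ℕ → Subset n → Bool
isLWalk {n} G l S = any (λ vs → isPath G vs ∧ subsetEqᵇ (vset vs) S) (allVecs n (suc l))

-- the vertex set V(I) of the interference graph, listed without repetition
lWalks : ∀ {n} → Graph n → ℕ → List (Subset n)
lWalks {n} G l = filterᵇ (isLWalk G l) (allSubsets n)

numWalks : ∀ {n} → Graph n → ℕ → ℕ
numWalks G l = length (lWalks G l)

-- the interference graph I(G,l) on Fin |V(I)|, the i-th vertex being the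
-- i-th l-walk; distinct walks are adjacent iff they share a vertex
interference : ∀ {n} → (G : Graph n) → (l : ℕ) → Graph (numWalks G l)
interference G l i j =
  not ⌊ i ≟ᶠ j ⌋ ∧ nonemptyᵇ (Data.List.lookup (lWalks G l) i ∩ Data.List.lookup (lWalks G l) j)

-- A rooted tree with k vertices in H is a triple (r , S , E) where
-- S ⊆ V(H) has k vertices, r ∈ S is the root, and E is an edge set of H
-- (a symmetric 0/1 matrix, rows indexed by vertices) with both endpoints in
-- S, such that (S , E) is a tree, i.e. connected with k - 1 edges.

EdgeSet : ℕ → Set
EdgeSet N = Vec (Subset N) N

edgeAt : ∀ {N} → EdgeSet N → Fin N → Fin N → Bool
edgeAt E i j = lookup (lookup E i) j

andAll : ∀ {N} → (Fin N → Bool) → Bool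
andAll {N} p = Vec.foldr (λ _ → Bool) _∧_ true (tabulate p)

orAll : ∀ {N} → (Fin N → Bool) → Bool
orAll {N} p = Vec.foldr (λ _ → Bool) _∨_ false (tabulate p)

_⇒ᵇ_ : Bool → Bool → Bool
a ⇒ᵇ b = not a ∨ b

reach : ∀ {N} → EdgeSet N → Fin N → ℕ → Subset N
reach E r zero    = ⁅ r ⁆
reach E r (suc t) = reach E r t ∪ tabulate (λ j → orAll (λ i → lookup (reach E r t) i ∧ edgeAt E i j))

twiceEdges : ∀ {N} → EdgeSet N → ℕ
twiceEdges E = Vec.foldr (λ _ → ℕ) (λ row s → ∣ row ∣ + s) 0 E

isRootedTree : ∀ {N} → Graph N → ℕ → Fin N → Subset N → EdgeSet N → Bool
isRootedTree H k r S E =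
  lookup S r
  ∧ (∣ S ∣ ≡ᵇ k)
  ∧ andAll (λ i → andAll (λ j →
        (edgeAt E i j ⇒ᵇ (H i j ∧ lookup S i ∧ lookup S j))
        ∧ (edgeAt E i j ⇒ᵇ edgeAt E j i)))
  ∧ (twiceEdges E ≡ᵇ 2 * (k ∸ 1))
  ∧ andAll (λ i → lookup S i ⇒ᵇ lookup (reach E r k) i)

numRootedTrees : ∀ {N} → Graph N → ℕ → ℕ
numRootedTrees {N} H k =
  length (filterᵇ (λ { (r , S , E) → isRootedTree H k r S E })
    (concatMap (λ r → concatMap (λ S → map (λ E → (r , S , E)) (allVecsOf (allSubsets N) N))
                                 (allSubsets N))
               (Data.List.allFin N)))

module Submission where

-- (i) As the girth exceeds l + 1, every non-backtracking walk on l + 1 vertices is a path, so a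
-- d-regular graph has n d (d-1)^(l-1) paths of length l. Such paths have no chords, hence each is
-- determined by its vertex set up to reversal, and every l-walk is the vertex set of exactly two.
-- (ii) Splitting a path at a vertex v into two arms shows that at most d (d-1)^(l-1) paths pass
-- through v at a given position; a walk meeting W does so at one of the l + 1 vertices of W and one
-- of l + 1 positions.
-- (iii) A rooted tree on k + 1 vertices in a graph of maximum degree Δ is recorded by its root and a
-- depth-first traversal: 2k up/down steps plus, for each down step, which of at most Δ neighbours is
-- entered. Every tree is obtained this way, by induction removing a leaf, so there are at most
-- N 4^k Δ^k of them.

open import Defs
open import Data.Nat using (ℕ; _+_; _*_; _∸_; _^_; _≤_)
open import Data.Nat.DivMod using (_/_)
open import Data.Product using (_×_; _,_)
open import Relation.Binary.PropositionalEquality using (_≡_; refl)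
open import Data.Bool using (false)

module Counting where

  open import Data.Bool using (Bool; true; false; _∧_; _∨_; T?)
  open import Data.Bool.Properties using (∧-conicalˡ; ∧-conicalʳ; ∧-identityʳ; ∧-zeroʳ; T-≡)
  open import Data.Nat
  open import Data.Nat.Properties
  open import Algebra.Properties.CommutativeSemigroup +-commutativeSemigroup using (interchange)
  open import Data.List using (List; []; _∷_; map; concatMap; filterᵇ; length; _++_)
  import Data.List.Properties as List
  open import Data.List.Membership.Propositional using (_∈_; _∉_; find; lose)
  import Data.List.Membership.Propositional.Properties as ∈
  open import Data.List.Relation.Unary.Any using (here; there)
  import Data.List.Relation.Unary.Any.Properties as Any
  open import Data.Bool.ListAction using (any)
  open import Data.List.Relation.Unary.All using (_∷_)
  open import Data.List.Relation.Unary.All.Properties using (¬Any⇒All¬; All¬⇒¬Any)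
  open import Data.List.Relation.Unary.Unique.Propositional using (Unique; []; _∷_)
  import Data.List.Relation.Unary.Unique.Propositional.Properties as Unique
  open import Data.Product using (∃)
  open import Data.Sum using (_⊎_; inj₁; inj₂)
  open import Data.Empty using (⊥; ⊥-elim)
  open import Function using (_∘_; Equivalence)
  open import Relation.Binary.PropositionalEquality

  ∧-true⁻ : ∀ a {b} → a ∧ b ≡ true → a ≡ true × b ≡ true
  ∧-true⁻ a e = ∧-conicalˡ a _ e , ∧-conicalʳ a _ e

  ∧∧-true⁻ : ∀ a b {c} → a ∧ (b ∧ c) ≡ true → a ≡ true × b ≡ true × c ≡ true
  ∧∧-true⁻ a b e = let x , y = ∧-true⁻ a e in x , ∧-true⁻ b y

  ∨-true⁻ : ∀ {a b} → a ∨ b ≡ true → a ≡ true ⊎ b ≡ true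
  ∨-true⁻ {true}  _ = inj₁ refl
  ∨-true⁻ {false} e = inj₂ e

  bool-ext : ∀ {a b : Bool} → (a ≡ true → b ≡ true) → (b ≡ true → a ≡ true) → a ≡ b
  bool-ext {true}  {true}  f g = refl
  bool-ext {true}  {false} f g = sym (f refl)
  bool-ext {false} {true}  f g = g refl
  bool-ext {false} {false} f g = refl

  iverson : Bool → ℕ
  iverson true  = 1
  iverson false = 0

  iverson-mono : ∀ {a b} → (a ≡ true → b ≡ true) → iverson a ≤ iverson b
  iverson-mono {false} h = z≤n
  iverson-mono {true}  h rewrite h refl = ≤-refl

  iverson-∨ : ∀ a b → iverson (a ∨ b) ≤ iverson a + iverson b
  iverson-∨ true  b = s≤s z≤n
  iverson-∨ false b = ≤-refl

  module _ {A : Set} where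

    countᵇ : (A → Bool) → List A → ℕ
    countᵇ p []       = 0
    countᵇ p (x ∷ xs) = iverson (p x) + countᵇ p xs

    sumMap : (A → ℕ) → List A → ℕ
    sumMap f []       = 0
    sumMap f (x ∷ xs) = f x + sumMap f xs

    ∈-filterᵇ⁻ : ∀ (p : A → Bool) {x} xs → x ∈ filterᵇ p xs → x ∈ xs × p x ≡ true
    ∈-filterᵇ⁻ p xs m = let x∈ , px = ∈.∈-filter⁻ (T? ∘ p) m in x∈ , Equivalence.to T-≡ px

    ∈-filterᵇ⁺ : ∀ (p : A → Bool) {x xs} → x ∈ xs → p x ≡ true → x ∈ filterᵇ p xs
    ∈-filterᵇ⁺ p m px = ∈.∈-filter⁺ (T? ∘ p) m (Equivalence.from T-≡ px)

    length-filterᵇ : ∀ (p : A → Bool) xs → length (filterᵇ p xs) ≡ countᵇ p xs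
    length-filterᵇ p []       = refl
    length-filterᵇ p (x ∷ xs) with p x
    ... | true  = cong suc (length-filterᵇ p xs)
    ... | false = length-filterᵇ p xs

    countᵇ-++ : ∀ (p : A → Bool) xs ys → countᵇ p (xs ++ ys) ≡ countᵇ p xs + countᵇ p ys
    countᵇ-++ p []       ys = refl
    countᵇ-++ p (x ∷ xs) ys = trans (cong (iverson (p x) +_) (countᵇ-++ p xs ys)) (sym (+-assoc (iverson (p x)) _ _))

    countᵇ-cong : ∀ (p q : A → Bool) xs → (∀ x → x ∈ xs → p x ≡ q x) → countᵇ p xs ≡ countᵇ q xs
    countᵇ-cong p q []       h = refl
    countᵇ-cong p q (x ∷ xs) h = cong₂ _+_ (cong iverson (h x (here refl))) (countᵇ-cong p q xs (λ y m → h y (there m)))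

    countᵇ-mono : ∀ (p q : A → Bool) xs → (∀ x → x ∈ xs → p x ≡ true → q x ≡ true) → countᵇ p xs ≤ countᵇ q xs
    countᵇ-mono p q []       h = z≤n
    countᵇ-mono p q (x ∷ xs) h = +-mono-≤ (iverson-mono (h x (here refl))) (countᵇ-mono p q xs (λ y m → h y (there m)))

    countᵇ-none : ∀ (p : A → Bool) xs → (∀ x → x ∈ xs → p x ≡ false) → countᵇ p xs ≡ 0
    countᵇ-none p []       h = refl
    countᵇ-none p (x ∷ xs) h rewrite h x (here refl) = countᵇ-none p xs (λ y m → h y (there m))

    countᵇ-∨-≤ : ∀ (p q : A → Bool) xs → countᵇ (λ x → p x ∨ q x) xs ≤ countᵇ p xs + countᵇ q xs
    countᵇ-∨-≤ p q []       = z≤n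
    countᵇ-∨-≤ p q (x ∷ xs) = ≤-trans (+-mono-≤ (iverson-∨ (p x) (q x)) (countᵇ-∨-≤ p q xs))
      (≤-reflexive (interchange (iverson (p x)) (iverson (q x)) (countᵇ p xs) (countᵇ q xs)))

    countᵇ-∨-disjoint : ∀ (p q : A → Bool) xs → (∀ x → x ∈ xs → p x ≡ true → q x ≡ true → ⊥) →
      countᵇ (λ x → p x ∨ q x) xs ≡ countᵇ p xs + countᵇ q xs
    countᵇ-∨-disjoint p q []       h = refl
    countᵇ-∨-disjoint p q (x ∷ xs) h with p x in px | q x in qx
    ... | true  | true  = ⊥-elim (h x (here refl) px qx)
    ... | true  | false = cong suc (countᵇ-∨-disjoint p q xs (λ y m → h y (there m)))
    ... | false | true  = trans (cong suc (countᵇ-∨-disjoint p q xs (λ y m → h y (there m)))) (sym (+-suc _ _))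
    ... | false | false = countᵇ-∨-disjoint p q xs (λ y m → h y (there m))

    sumMap-cong : ∀ (f g : A → ℕ) xs → (∀ x → x ∈ xs → f x ≡ g x) → sumMap f xs ≡ sumMap g xs
    sumMap-cong f g []       h = refl
    sumMap-cong f g (x ∷ xs) h = cong₂ _+_ (h x (here refl)) (sumMap-cong f g xs (λ y m → h y (there m)))

    sumMap-mono : ∀ (f g : A → ℕ) xs → (∀ x → x ∈ xs → f x ≤ g x) → sumMap f xs ≤ sumMap g xs
    sumMap-mono f g []       h = z≤n
    sumMap-mono f g (x ∷ xs) h = +-mono-≤ (h x (here refl)) (sumMap-mono f g xs (λ y m → h y (there m)))

    sumMap-const : ∀ c xs → sumMap (λ _ → c) xs ≡ length xs * c
    sumMap-const c []       = refl
    sumMap-const c (x ∷ xs) = cong (c +_) (sumMap-const c xs)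

    sumMap-+ : ∀ (f g : A → ℕ) xs → sumMap (λ x → f x + g x) xs ≡ sumMap f xs + sumMap g xs
    sumMap-+ f g []       = refl
    sumMap-+ f g (x ∷ xs) rewrite sumMap-+ f g xs = interchange (f x) (g x) (sumMap f xs) (sumMap g xs)

    sumMap-*ˡ : ∀ c (f : A → ℕ) xs → sumMap (λ x → c * f x) xs ≡ c * sumMap f xs
    sumMap-*ˡ c f []       = sym (*-zeroʳ c)
    sumMap-*ˡ c f (x ∷ xs) = trans (cong (c * f x +_) (sumMap-*ˡ c f xs)) (sym (*-distribˡ-+ c (f x) _))

    sumMap-iverson : ∀ (p : A → Bool) xs → sumMap (λ x → iverson (p x)) xs ≡ countᵇ p xs
    sumMap-iverson p []       = refl
    sumMap-iverson p (x ∷ xs) = cong (iverson (p x) +_) (sumMap-iverson p xs)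

    sumMap-iverson-* : ∀ (p : A → Bool) c xs → sumMap (λ x → iverson (p x) * c) xs ≡ countᵇ p xs * c
    sumMap-iverson-* p c []       = refl
    sumMap-iverson-* p c (x ∷ xs) =
      trans (cong (iverson (p x) * c +_) (sumMap-iverson-* p c xs)) (sym (*-distribʳ-+ c (iverson (p x)) _))

  module _ {A : Set} where

    countᵇ-∧-const : ∀ a b (p : A → Bool) xs → countᵇ (λ x → (a ∧ p x) ∧ b) xs ≡ iverson (a ∧ b) * countᵇ p xs
    countᵇ-∧-const true  true  p xs = trans (countᵇ-cong _ p xs (λ x _ → ∧-identityʳ (p x))) (sym (+-identityʳ _))
    countᵇ-∧-const true  false p xs = countᵇ-none _ xs (λ x _ → ∧-zeroʳ (p x))
    countᵇ-∧-const false b     p xs = countᵇ-none _ xs (λ x _ → refl)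

  module _ {A B : Set} where

    countᵇ-map : ∀ (p : B → Bool) (f : A → B) xs → countᵇ p (map f xs) ≡ countᵇ (p ∘ f) xs
    countᵇ-map p f []       = refl
    countᵇ-map p f (x ∷ xs) = cong (iverson (p (f x)) +_) (countᵇ-map p f xs)

    countᵇ-concatMap : ∀ (p : B → Bool) (f : A → List B) xs →
      countᵇ p (concatMap f xs) ≡ sumMap (λ x → countᵇ p (f x)) xs
    countᵇ-concatMap p f []       = refl
    countᵇ-concatMap p f (x ∷ xs) =
      trans (countᵇ-++ p (f x) (concatMap f xs)) (cong (countᵇ p (f x) +_) (countᵇ-concatMap p f xs))

    length-concatMap : ∀ (f : A → List B) xs → length (concatMap f xs) ≡ sumMap (λ x → length (f x)) xs
    length-concatMap f []       = refl
    length-concatMap f (x ∷ xs) =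
      trans (List.length-++ (f x)) (cong (length (f x) +_) (length-concatMap f xs))

    sumMap-countᵇ-comm : ∀ (p : A → B → Bool) xs ys →
      sumMap (λ y → countᵇ (λ x → p x y) xs) ys ≡ sumMap (λ x → countᵇ (p x) ys) xs
    sumMap-countᵇ-comm p []       ys = trans (sumMap-const 0 ys) (*-zeroʳ (length ys))
    sumMap-countᵇ-comm p (x ∷ xs) ys =
      trans (sumMap-+ (λ y → iverson (p x y)) (λ y → countᵇ (λ x' → p x' y) xs) ys)
            (cong₂ _+_ (sumMap-iverson (p x) ys) (sumMap-countᵇ-comm p xs ys))

    ∈-concatMap⁺ : ∀ (f : A → List B) {a y as} → a ∈ as → y ∈ f a → y ∈ concatMap f as
    ∈-concatMap⁺ f a∈ y∈ = ∈.∈-concatMap⁺ f (lose a∈ y∈)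

    ∈-concatMap⁻ : ∀ (f : A → List B) {y} as → y ∈ concatMap f as → ∃ λ a → a ∈ as × y ∈ f a
    ∈-concatMap⁻ f as m = find (∈.∈-concatMap⁻ f {xs = as} m)

  module _ {A : Set} where

    unique-∷ : ∀ {x : A} {xs} → x ∉ xs → Unique xs → Unique (x ∷ xs)
    unique-∷ {xs = xs} x∉ u = ¬Any⇒All¬ xs x∉ ∷ u

    unique-head : ∀ {x : A} {xs} → Unique (x ∷ xs) → x ∉ xs
    unique-head (x≢ ∷ _) = All¬⇒¬Any x≢

    unique-tail : ∀ {x : A} {xs} → Unique (x ∷ xs) → Unique xs
    unique-tail (_ ∷ u) = u

    Unique-⊆⇒length≤ : ∀ {xs ys : List A} → Unique xs → (∀ x → x ∈ xs → x ∈ ys) → length xs ≤ length ys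
    Unique-⊆⇒length≤ {[]}     u h = z≤n
    Unique-⊆⇒length≤ {x ∷ xs} u h =
      ≤-trans (s≤s (Unique-⊆⇒length≤ (unique-tail u)
                      (λ y y∈ → ∈-delete x∈ (h y (there y∈)) (λ { refl → unique-head u y∈ }))))
              (≤-reflexive (length-delete x∈))
      where
      x∈ = h x (here refl)
      delete : ∀ {y : A} {ys} → y ∈ ys → List A
      delete {ys = _ ∷ ys} (here _)  = ys
      delete {ys = y ∷ _}  (there m) = y ∷ delete m
      length-delete : ∀ {y : A} {ys} (m : y ∈ ys) → suc (length (delete m)) ≡ length ys
      length-delete (here _)  = refl
      length-delete (there m) = cong suc (length-delete m)
      ∈-delete : ∀ {y z : A} {ys} (m : y ∈ ys) → z ∈ ys → z ≢ y → z ∈ delete m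
      ∈-delete (here refl) (here refl) z≢y = ⊥-elim (z≢y refl)
      ∈-delete (here refl) (there k)   z≢y = k
      ∈-delete (there m)   (here refl) z≢y = here refl
      ∈-delete (there m)   (there k)   z≢y = there (∈-delete m k z≢y)

    unique-filterᵇ : ∀ (p : A → Bool) {xs} → Unique xs → Unique (filterᵇ p xs)
    unique-filterᵇ p = Unique.filter⁺ (T? ∘ p)

    countᵇ-unique : ∀ (p : A → Bool) {xs a} → Unique xs → a ∈ xs → p a ≡ true →
      (∀ x → x ∈ xs → p x ≡ true → x ≡ a) → countᵇ p xs ≡ 1
    countᵇ-unique p u (here refl) pa only rewrite pa =
      cong suc (countᵇ-none p _ λ y y∈ → others y y∈)
      where
      others : ∀ y → y ∈ _ → p y ≡ false
      others y y∈ with p y in py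
      ... | true  = ⊥-elim (unique-head u (subst (_∈ _) (only y (there y∈) py) y∈))
      ... | false = refl
    countᵇ-unique p {x ∷ xs} u (there a∈) pa only with p x in px
    ... | true  = ⊥-elim (unique-head u (subst (_∈ xs) (sym (only x (here refl) px)) a∈))
    ... | false = countᵇ-unique p (unique-tail u) a∈ pa (λ y m → only y (there m))

  module _ {A B : Set} where

    unique-map : ∀ (f : A → B) {xs} → Unique xs → (∀ x y → x ∈ xs → y ∈ xs → f x ≡ f y → x ≡ y) →
      Unique (map f xs)
    unique-map f []            inj = []
    unique-map f {x ∷ xs} u inj =
      unique-∷ fx∉ (unique-map f (unique-tail u) (λ a b a∈ b∈ → inj a b (there a∈) (there b∈)))
      where
      fx∉ : f x ∉ map f xs
      fx∉ m = let y , y∈ , e = ∈.∈-map⁻ f m in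
        unique-head u (subst (_∈ xs) (sym (inj x y (here refl) (there y∈) e)) y∈)

    injective⇒length≤ : ∀ (f : A → B) {xs ys} → Unique xs → (∀ x y → x ∈ xs → y ∈ xs → f x ≡ f y → x ≡ y) →
      (∀ x → x ∈ xs → f x ∈ ys) → length xs ≤ length ys
    injective⇒length≤ f {xs} u inj into =
      ≤-trans (≤-reflexive (sym (List.length-map f xs)))
        (Unique-⊆⇒length≤ (unique-map f u inj)
          (λ y m → let x , x∈ , e = ∈.∈-map⁻ f m in subst (_∈ _) (sym e) (into x x∈)))

    unique-concatMap : ∀ (f : A → List B) {as} → Unique as → (∀ a → a ∈ as → Unique (f a)) →
      (∀ a b y → a ∈ as → b ∈ as → y ∈ f a → y ∈ f b → a ≡ b) → Unique (concatMap f as)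
    unique-concatMap f []            h d = []
    unique-concatMap f {a ∷ as} u h d =
      Unique.++⁺ (h a (here refl))
        (unique-concatMap f (unique-tail u) (λ b m → h b (there m)) (λ b c y b∈ c∈ → d b c y (there b∈) (there c∈)))
        (λ (ya , yr) → let b , b∈ , yb = ∈-concatMap⁻ f as yr in
           unique-head u (subst (_∈ as) (sym (d a b _ (here refl) (there b∈) ya yb)) b∈))

  false≢true : false ≢ true
  false≢true ()

  module _ {A : Set} where

    unique-++ˡ : ∀ (xs ys : List A) → Unique (xs ++ ys) → Unique xs
    unique-++ˡ []       ys u = []
    unique-++ˡ (x ∷ xs) ys u = unique-∷ (λ m → unique-head u (∈.∈-++⁺ˡ m)) (unique-++ˡ xs ys (unique-tail u))

    unique-++ʳ : ∀ (xs ys : List A) → Unique (xs ++ ys) → Unique ys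
    unique-++ʳ []       ys u = u
    unique-++ʳ (x ∷ xs) ys u = unique-++ʳ xs ys (unique-tail u)

    unique-++-disjoint : ∀ (xs ys : List A) {x} → Unique (xs ++ ys) → x ∈ xs → x ∈ ys → ⊥
    unique-++-disjoint (z ∷ xs) ys u (here refl) m = unique-head u (∈.∈-++⁺ʳ xs m)
    unique-++-disjoint (z ∷ xs) ys u (there k)   m = unique-++-disjoint xs ys (unique-tail u) k m

    any-true⁻ : ∀ (p : A → Bool) xs → any p xs ≡ true → ∃ λ x → x ∈ xs × p x ≡ true
    any-true⁻ p xs e = let x , x∈ , px = find (Any.any⁻ p xs (Equivalence.from T-≡ e)) in x , x∈ , Equivalence.to T-≡ px

    any-true⁺ : ∀ (p : A → Bool) {x xs} → x ∈ xs → p x ≡ true → any p xs ≡ true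
    any-true⁺ p x∈ px = Equivalence.to T-≡ (Any.any⁺ p (lose x∈ (Equivalence.from T-≡ px)))

module Enumeration where

  open import Data.Bool using (Bool; true; false)
  open import Data.Nat
  open import Data.List using (List; []; _∷_; map; concatMap; length)
  import Data.List as List
  import Data.List.Properties as List
  open import Data.Vec using (Vec; []; _∷_; toList)
  open import Data.List.Membership.Propositional using (_∈_)
  open import Data.List.Membership.Propositional.Properties using (∈-map⁺; ∈-map⁻)
  open import Data.List.Relation.Unary.Any using (here; there)
  open import Data.List.Relation.Unary.Unique.Propositional using (Unique; []; _∷_)
  open import Data.List.Relation.Unary.Unique.Propositional.Properties using (allFin⁺; map⁻)
  open import Data.Fin.Subset using (Subset)
  open import Relation.Binary.PropositionalEquality
  open Counting

  booleans : List Bool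
  booleans = true ∷ false ∷ []

  allVecs≡allVecsOf : ∀ n m → allVecs n m ≡ allVecsOf (List.allFin n) m
  allVecs≡allVecsOf n zero    = refl
  allVecs≡allVecsOf n (suc m) = cong (λ V → concatMap (λ x → map (x ∷_) V) (List.allFin n)) (allVecs≡allVecsOf n m)

  allSubsets≡allVecsOf : ∀ n → allSubsets n ≡ allVecsOf booleans n
  allSubsets≡allVecsOf zero    = refl
  allSubsets≡allVecsOf (suc n) = cong (λ V → concatMap (λ x → map (x ∷_) V) booleans) (allSubsets≡allVecsOf n)

  module _ {A : Set} where

    allLists : List A → ℕ → List (List A)
    allLists xs zero    = [] ∷ []
    allLists xs (suc m) = concatMap (λ x → map (x ∷_) (allLists xs m)) xs

    map-toList-allVecsOf : ∀ (xs : List A) m → map toList (allVecsOf xs m) ≡ allLists xs m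
    map-toList-allVecsOf xs zero    = refl
    map-toList-allVecsOf xs (suc m) =
      trans (go xs) (cong (λ V → concatMap (λ x → map (x ∷_) V) xs) (map-toList-allVecsOf xs m))
      where
      go : ∀ ys → map toList (concatMap (λ x → map (x ∷_) (allVecsOf xs m)) ys)
                ≡ concatMap (λ x → map (x ∷_) (map toList (allVecsOf xs m))) ys
      go []       = refl
      go (y ∷ ys) = trans (List.map-++ toList (map (y ∷_) (allVecsOf xs m)) _)
        (cong₂ List._++_ (trans (sym (List.map-∘ (allVecsOf xs m))) (List.map-∘ (allVecsOf xs m))) (go ys))

    ∈-allVecsOf : ∀ {xs : List A} → (∀ a → a ∈ xs) → ∀ {m} (v : Vec A m) → v ∈ allVecsOf xs m
    ∈-allVecsOf all∈ []      = here refl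
    ∈-allVecsOf all∈ (a ∷ v) = ∈-concatMap⁺ _ (all∈ a) (∈-map⁺ (a ∷_) (∈-allVecsOf all∈ v))

    ∈-allLists : ∀ {xs : List A} → (∀ a → a ∈ xs) → ∀ ys → ys ∈ allLists xs (length ys)
    ∈-allLists all∈ []       = here refl
    ∈-allLists all∈ (a ∷ ys) = ∈-concatMap⁺ _ (all∈ a) (∈-map⁺ (a ∷_) (∈-allLists all∈ ys))

    ∈-allLists⇒length : ∀ (xs : List A) m {ys} → ys ∈ allLists xs m → length ys ≡ m
    ∈-allLists⇒length xs zero    (here refl) = refl
    ∈-allLists⇒length xs (suc m) k =
      let a , _ , k′ = ∈-concatMap⁻ _ xs k
          zs , zs∈ , e = ∈-map⁻ (a ∷_) k′
      in trans (cong length e) (cong suc (∈-allLists⇒length xs m zs∈))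

    unique-allLists : ∀ {xs : List A} → Unique xs → ∀ m → Unique (allLists xs m)
    unique-allLists u zero    = unique-∷ (λ ()) []
    unique-allLists u (suc m) =
      unique-concatMap _ u (λ a _ → unique-map (a ∷_) (unique-allLists u m) (λ { _ _ _ _ refl → refl }))
        (λ a b y _ _ ya yb →
           let _ , _ , e₁ = ∈-map⁻ (a ∷_) ya
               _ , _ , e₂ = ∈-map⁻ (b ∷_) yb
           in List.∷-injectiveˡ (trans (sym e₁) e₂))

    unique-allVecsOf : ∀ {xs : List A} → Unique xs → ∀ m → Unique (allVecsOf xs m)
    unique-allVecsOf {xs} u m = map⁻ (subst Unique (sym (map-toList-allVecsOf xs m)) (unique-allLists u m))

    length-allLists : ∀ (xs : List A) m → length (allLists xs m) ≡ length xs ^ m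
    length-allLists xs zero    = refl
    length-allLists xs (suc m) =
      trans (length-concatMap _ xs)
        (trans (sumMap-cong _ (λ _ → length xs ^ m) xs
                  (λ x _ → trans (List.length-map (x ∷_) (allLists xs m)) (length-allLists xs m)))
          (sumMap-const (length xs ^ m) xs))

  unique-booleans : Unique booleans
  unique-booleans = unique-∷ (λ { (here ()) ; (there ()) }) (unique-∷ (λ ()) [])

  ∈-booleans : ∀ b → b ∈ booleans
  ∈-booleans true  = here refl
  ∈-booleans false = there (here refl)

  unique-allSubsets : ∀ n → Unique (allSubsets n)
  unique-allSubsets n = subst Unique (sym (allSubsets≡allVecsOf n)) (unique-allVecsOf unique-booleans n)

  ∈-allSubsets : ∀ {n} (S : Subset n) → S ∈ allSubsets n
  ∈-allSubsets {n} S = subst (S ∈_) (sym (allSubsets≡allVecsOf n)) (∈-allVecsOf ∈-booleans S)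

  unique-allFinLists : ∀ n m → Unique (allLists (List.allFin n) m)
  unique-allFinLists n = unique-allLists (allFin⁺ n)

module FinCounting where

  open import Data.Bool using (Bool; true; false; _∧_; _∨_; not)
  open import Data.Bool.Properties using (∧-conicalʳ; ∧-identityʳ; ∨-identityʳ; ∨-zeroʳ)
  open import Data.Nat
  open import Data.Nat.Properties
  open import Algebra.Properties.CommutativeSemigroup +-commutativeSemigroup using (interchange)
  open import Data.Fin using (Fin; zero; suc) renaming (_≟_ to _≟ᶠ_)
  import Data.List as List
  import Data.List.Properties as List
  open import Data.Product using (∃)
  open import Data.Sum using (_⊎_; inj₁; inj₂)
  open import Data.Empty using (⊥; ⊥-elim)
  open import Relation.Binary.PropositionalEquality
  open import Relation.Nullary using (yes; no)
  open import Relation.Nullary.Decidable using (⌊_⌋)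
  open Counting

  eqFin : ∀ {N} → Fin N → Fin N → Bool
  eqFin i j = ⌊ i ≟ᶠ j ⌋

  eqFin-refl : ∀ {N} (i : Fin N) → eqFin i i ≡ true
  eqFin-refl i with i ≟ᶠ i
  ... | yes _ = refl
  ... | no ne = ⊥-elim (ne refl)

  eqFin⇒≡ : ∀ {N} {i j : Fin N} → eqFin i j ≡ true → i ≡ j
  eqFin⇒≡ {i = i} {j} e with i ≟ᶠ j
  ... | yes p = p
  eqFin⇒≡ () | no _

  ≢⇒eqFin-false : ∀ {N} {i j : Fin N} → i ≢ j → eqFin i j ≡ false
  ≢⇒eqFin-false {i = i} {j} ne with i ≟ᶠ j
  ... | yes p = ⊥-elim (ne p)
  ... | no _ = refl

  eqFin-suc : ∀ {N} (i a : Fin N) → eqFin (suc i) (suc a) ≡ eqFin i a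
  eqFin-suc i a with i ≟ᶠ a
  ... | yes _ = refl
  ... | no _  = refl

  countFin : ∀ {N} → (Fin N → Bool) → ℕ
  countFin {zero} f = 0
  countFin {suc N} f = iverson (f zero) + countFin (λ i → f (suc i))

  sumFin : ∀ {N} → (Fin N → ℕ) → ℕ
  sumFin {zero} f = 0
  sumFin {suc N} f = f zero + sumFin (λ i → f (suc i))

  countFin-cong : ∀ {N} (f g : Fin N → Bool) → (∀ i → f i ≡ g i) → countFin f ≡ countFin g
  countFin-cong {zero} f g h = refl
  countFin-cong {suc N} f g h = cong₂ _+_ (cong iverson (h zero)) (countFin-cong _ _ (λ i → h (suc i)))

  sumFin-cong : ∀ {N} (f g : Fin N → ℕ) → (∀ i → f i ≡ g i) → sumFin f ≡ sumFin g
  sumFin-cong {zero} f g h = refl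
  sumFin-cong {suc N} f g h = cong₂ _+_ (h zero) (sumFin-cong _ _ (λ i → h (suc i)))

  countFin-mono : ∀ {N} (f g : Fin N → Bool) → (∀ i → f i ≡ true → g i ≡ true) → countFin f ≤ countFin g
  countFin-mono {zero} f g h = z≤n
  countFin-mono {suc N} f g h = +-mono-≤ (iverson-mono (h zero)) (countFin-mono _ _ (λ i → h (suc i)))

  sumFin-mono : ∀ {N} (f g : Fin N → ℕ) → (∀ i → f i ≤ g i) → sumFin f ≤ sumFin g
  sumFin-mono {zero} f g h = z≤n
  sumFin-mono {suc N} f g h = +-mono-≤ (h zero) (sumFin-mono _ _ (λ i → h (suc i)))

  sumFin-+ : ∀ {N} (f g : Fin N → ℕ) → sumFin (λ i → f i + g i) ≡ sumFin f + sumFin g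
  sumFin-+ {zero} f g = refl
  sumFin-+ {suc N} f g rewrite sumFin-+ (λ i → f (suc i)) (λ i → g (suc i)) = interchange (f zero) (g zero) _ _

  sumFin-iverson : ∀ {N} (f : Fin N → Bool) → sumFin (λ i → iverson (f i)) ≡ countFin f
  sumFin-iverson {zero} f = refl
  sumFin-iverson {suc N} f = cong (iverson (f zero) +_) (sumFin-iverson (λ i → f (suc i)))

  countFin-∨-disjoint : ∀ {N} (f g : Fin N → Bool) → (∀ i → f i ≡ true → g i ≡ true → ⊥) →
    countFin (λ i → f i ∨ g i) ≡ countFin f + countFin g
  countFin-∨-disjoint {zero} f g h = refl
  countFin-∨-disjoint {suc N} f g h with f zero in e1 | g zero in e2
  ... | true | true = ⊥-elim (h zero e1 e2)
  ... | true | false = cong suc (countFin-∨-disjoint _ _ (λ i → h (suc i)))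
  ... | false | true = trans (cong suc (countFin-∨-disjoint _ _ (λ i → h (suc i)))) (sym (+-suc _ _))
  ... | false | false = countFin-∨-disjoint _ _ (λ i → h (suc i))

  countFin-none : ∀ {N} (f : Fin N → Bool) → (∀ i → f i ≡ false) → countFin f ≡ 0
  countFin-none {zero} f h = refl
  countFin-none {suc N} f h rewrite h zero = countFin-none _ (λ i → h (suc i))

  countFin-singleton : ∀ {N} (b : Bool) (a : Fin N) → countFin (λ i → b ∧ eqFin i a) ≡ iverson b
  countFin-singleton {N} false a = countFin-none {N} _ (λ i → refl)
  countFin-singleton {suc N} true zero = cong suc (countFin-none {N} _ (λ i → refl))
  countFin-singleton {suc N} true (suc a) =
    trans (cong (iverson (eqFin {suc N} zero (suc a)) +_) (countFin-cong _ _ (λ i → eqFin-suc i a)))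
          (countFin-singleton true a)

  countFin-≥1 : ∀ {N} (f : Fin N → Bool) a → f a ≡ true → 1 ≤ countFin f
  countFin-≥1 {suc N} f zero e rewrite e = s≤s z≤n
  countFin-≥1 {suc N} f (suc a) e = ≤-trans (countFin-≥1 _ a e) (m≤n+m _ (iverson (f zero)))

  searchFin : ∀ {N} (f : Fin N → Bool) → (∃ λ i → f i ≡ true) ⊎ (∀ i → f i ≡ false)
  searchFin {zero} f = inj₂ (λ ())
  searchFin {suc N} f with f zero in e
  ... | true = inj₁ (zero , e)
  ... | false with searchFin (λ i → f (suc i))
  ...   | inj₁ (i , p) = inj₁ (suc i , p)
  ...   | inj₂ h = inj₂ (λ { zero → e ; (suc i) → h i })

  countFin-witness : ∀ {N} (f : Fin N → Bool) → 1 ≤ countFin f → ∃ λ i → f i ≡ true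
  countFin-witness f le with searchFin f
  ... | inj₁ w = w
  ... | inj₂ h = ⊥-elim (1+n≰n (≤-trans le (≤-reflexive (countFin-none f h))))

  countFin≡countᵇ : ∀ {N} (f : Fin N → Bool) → countFin f ≡ countᵇ f (List.allFin N)
  countFin≡countᵇ {zero} f = refl
  countFin≡countᵇ {suc N} f = cong (iverson (f zero) +_) (trans (countFin≡countᵇ (λ i → f (suc i)))
    (sym (trans (cong (countᵇ f) (sym (List.map-tabulate (λ i → i) suc))) (countᵇ-map f suc (List.allFin N)))))

  eqFin-cases : ∀ {N} (i j : Fin N) → (i ≡ j × eqFin i j ≡ true) ⊎ (i ≢ j × eqFin i j ≡ false)
  eqFin-cases i j with i ≟ᶠ j
  ... | yes refl = inj₁ (refl , refl)
  ... | no i≢j   = inj₂ (i≢j , refl)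

  sumFin-≥ : ∀ {N} (f : Fin N → ℕ) i → f i ≤ sumFin f
  sumFin-≥ {suc N} f zero = m≤m+n (f zero) _
  sumFin-≥ {suc N} f (suc i) = ≤-trans (sumFin-≥ (λ j → f (suc j)) i) (m≤n+m _ (f zero))

  not-eqFin : ∀ {N} {i j : Fin N} → i ≢ j → not (eqFin i j) ≡ true
  not-eqFin i≢j rewrite ≢⇒eqFin-false i≢j = refl

  not-eqFin⁻ : ∀ {N} {i j : Fin N} → not (eqFin i j) ≡ true → i ≢ j
  not-eqFin⁻ {i = i} e refl rewrite eqFin-refl i = false≢true e

  erase : ∀ {N} → (Fin N → Bool) → Fin N → Fin N → Bool
  erase f a i = f i ∧ not (eqFin i a)

  countFin-erase : ∀ {N} (f : Fin N → Bool) a → f a ≡ true → countFin f ≡ suc (countFin (erase f a))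
  countFin-erase f a fa = begin
    countFin f                                              ≡⟨ countFin-cong f _ split ⟩
    countFin (λ i → erase f a i ∨ (true ∧ eqFin i a))       ≡⟨ countFin-∨-disjoint _ _ disjoint ⟩
    countFin (erase f a) + countFin (λ i → true ∧ eqFin i a) ≡⟨ cong (countFin (erase f a) +_) (countFin-singleton true a) ⟩
    countFin (erase f a) + 1                                ≡⟨ +-comm _ 1 ⟩
    suc (countFin (erase f a))                              ∎
    where
    open ≡-Reasoning
    split : ∀ i → f i ≡ (erase f a i ∨ (true ∧ eqFin i a))
    split i with eqFin-cases i a
    ... | inj₁ (refl , e) rewrite e = trans fa (sym (∨-zeroʳ (f i ∧ false)))
    ... | inj₂ (_ , e)    rewrite e = sym (trans (∨-identityʳ _) (∧-identityʳ (f i)))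
    disjoint : ∀ i → erase f a i ≡ true → (true ∧ eqFin i a) ≡ true → ⊥
    disjoint i x y = false≢true (trans (sym (cong not y)) (∧-conicalʳ (f i) _ x))

  countFin≡1⇒unique : ∀ {N} (f : Fin N → Bool) → countFin f ≡ 1 → ∀ a b → f a ≡ true → f b ≡ true → a ≡ b
  countFin≡1⇒unique f one a b fa fb with a ≟ᶠ b
  ... | yes a≡b = a≡b
  ... | no  a≢b = ⊥-elim (1+n≰n (≤-trans (countFin-≥1 (erase f a) b (cong₂ _∧_ fb (not-eqFin (λ b≡a → a≢b (sym b≡a)))))
                                         (≤-reflexive (suc-injective (trans (sym (countFin-erase f a fa)) one)))))

module Unfolding where

  open import Data.Bool using (Bool; true; false; _∧_; _∨_)
  open import Data.Nat
  open import Data.Nat.Properties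
  open import Data.Fin using (Fin; zero; suc)
  open import Data.Fin.Subset using (Subset; ⁅_⁆; _∪_; ∣_∣)
  open import Data.Vec using (Vec; []; _∷_; lookup; tabulate)
  import Data.Vec as Vec
  import Data.Vec.Properties as Vec
  open import Data.Product using (∃)
  open import Relation.Binary.PropositionalEquality
  open Counting
  open FinCounting

  ∣∣≡countFin : ∀ {N} (S : Subset N) → ∣ S ∣ ≡ countFin (lookup S)
  ∣∣≡countFin []          = refl
  ∣∣≡countFin (true ∷ S)  = cong suc (∣∣≡countFin S)
  ∣∣≡countFin (false ∷ S) = ∣∣≡countFin S

  lookup-∪ : ∀ {N} (S T : Subset N) i → lookup (S ∪ T) i ≡ (lookup S i ∨ lookup T i)
  lookup-∪ S T i = Vec.lookup-zipWith _∨_ i S T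

  lookup-⁅⁆ : ∀ {N} (x i : Fin N) → lookup ⁅ x ⁆ i ≡ eqFin i x
  lookup-⁅⁆ zero    zero    = refl
  lookup-⁅⁆ zero    (suc i) = Vec.lookup-replicate i false
  lookup-⁅⁆ (suc x) zero    = refl
  lookup-⁅⁆ (suc x) (suc i) = trans (lookup-⁅⁆ x i) (sym (eqFin-suc i x))

  orAll-true⁻ : ∀ {N} (p : Fin N → Bool) → orAll p ≡ true → ∃ λ i → p i ≡ true
  orAll-true⁻ {suc N} p e with p zero in p0
  ... | true  = zero , p0
  ... | false = let i , pi = orAll-true⁻ (λ i → p (suc i)) e in suc i , pi

  orAll-true⁺ : ∀ {N} (p : Fin N → Bool) i → p i ≡ true → orAll p ≡ true
  orAll-true⁺ {suc N} p zero    e rewrite e = refl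
  orAll-true⁺ {suc N} p (suc i) e with p zero
  ... | true  = refl
  ... | false = orAll-true⁺ (λ i → p (suc i)) i e

  andAll-true⁻ : ∀ {N} (p : Fin N → Bool) → andAll p ≡ true → ∀ i → p i ≡ true
  andAll-true⁻ {suc N} p e i with p zero in p0
  andAll-true⁻ {suc N} p e  zero    | true  = p0
  andAll-true⁻ {suc N} p e  (suc i) | true  = andAll-true⁻ (λ i → p (suc i)) e i
  andAll-true⁻ {suc N} p () i       | false

  twiceEdges≡sumFin : ∀ {N} (E : EdgeSet N) → twiceEdges E ≡ sumFin (λ i → countFin (edgeAt E i))
  twiceEdges≡sumFin = go
    where
    go : ∀ {N M} (E : Vec (Subset N) M) →
      Vec.foldr (λ _ → ℕ) (λ row s → ∣ row ∣ + s) 0 E ≡ sumFin (λ i → countFin (lookup (lookup E i)))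
    go []        = refl
    go (row ∷ E) = cong₂ _+_ (∣∣≡countFin row) (go E)

  degree≡countFin : ∀ {N} (G : Graph N) i → degree G i ≡ countFin (G i)
  degree≡countFin G i = trans (∣∣≡countFin (tabulate (G i))) (countFin-cong _ _ (Vec.lookup∘tabulate (G i)))

  degree≤maxDegree : ∀ {N} (G : Graph N) i → degree G i ≤ maxDegree G
  degree≤maxDegree {N} G i =
    subst (λ j → degree G j ≤ maxDegree G) (Vec.lookup-allFin i) (go (Vec.allFin N) i)
    where
    go : ∀ {M} (v : Vec (Fin N) M) j → degree G (lookup v j) ≤ Vec.foldr (λ _ → ℕ) (λ i m → degree G i ⊔ m) 0 v
    go (x ∷ v) zero    = m≤m⊔n (degree G x) _
    go (x ∷ v) (suc j) = ≤-trans (go v j) (m≤n⊔m (degree G x) _)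

  maxDegree≤ : ∀ {N} (G : Graph N) B → (∀ i → degree G i ≤ B) → maxDegree G ≤ B
  maxDegree≤ {N} G B bound = go (Vec.allFin N)
    where
    go : ∀ {M} (v : Vec (Fin N) M) → Vec.foldr (λ _ → ℕ) (λ i m → degree G i ⊔ m) 0 v ≤ B
    go []      = z≤n
    go (x ∷ v) = ⊔-lub (bound x) (go v)

  Reach : ∀ {N} → (Fin N → Fin N → Bool) → Fin N → ℕ → Fin N → Bool
  Reach E r zero    i = eqFin i r
  Reach E r (suc t) j = Reach E r t j ∨ orAll (λ i → Reach E r t i ∧ E i j)

  lookup-reach : ∀ {N} (E : EdgeSet N) r t j → lookup (reach E r t) j ≡ Reach (edgeAt E) r t j
  lookup-reach E r zero    j = lookup-⁅⁆ r j
  lookup-reach E r (suc t) j =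
    trans (lookup-∪ (reach E r t) _ j)
      (cong₂ _∨_ (lookup-reach E r t j)
        (trans (Vec.lookup∘tabulate _ j)
          (cong (Vec.foldr (λ _ → Bool) _∨_ false)
            (Vec.tabulate-cong (λ i → cong (_∧ edgeAt E i j) (lookup-reach E r t i))))))

module RootedTrees where

  open import Data.Bool using (Bool; true; false; _∧_; _∨_; not)
  open import Data.Bool.Properties using (∧-identityʳ; ∨-identityʳ; ∨-zeroʳ; T-≡)
  open import Function using (Equivalence)
  open import Data.Nat
  open import Data.Nat.Properties
  open import Data.Fin using (Fin) renaming (_≟_ to _≟ᶠ_)
  open import Data.Product using (∃; proj₁; proj₂)
  open import Data.Sum using (inj₁; inj₂)
  open import Data.Empty using (⊥; ⊥-elim)
  open import Relation.Binary.PropositionalEquality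
  open import Relation.Nullary using (yes; no)
  open Counting
  open FinCounting
  open Unfolding

  -- t bounds the number of steps in which the root r reaches every vertex of the tree.
  record RootedTree {N} (H : Graph N) (k t : ℕ) (r : Fin N) (S : Fin N → Bool) (E : Fin N → Fin N → Bool) : Set where
    field
      root∈         : S r ≡ true
      size          : countFin S ≡ k
      edge⇒adjacent : ∀ i j → E i j ≡ true → H i j ≡ true × S i ≡ true × S j ≡ true
      edge-sym      : ∀ i j → E i j ≡ true → E j i ≡ true
      edgeCount     : sumFin (λ i → countFin (E i)) ≡ 2 * (k ∸ 1)
      reachable     : ∀ i → S i ≡ true → Reach E r t i ≡ true

  module _ {N} (E : Fin N → Fin N → Bool) (r : Fin N) where

    Reach-step : ∀ t i → Reach E r t i ≡ true → Reach E r (suc t) i ≡ true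
    Reach-step t i e rewrite e = refl

    Reach⇒predecessor : ∀ t i → Reach E r t i ≡ true → i ≢ r → ∃ λ j → E j i ≡ true
    Reach⇒predecessor zero    i e i≢r = ⊥-elim (i≢r (eqFin⇒≡ e))
    Reach⇒predecessor (suc t) i e i≢r with ∨-true⁻ e
    ... | inj₁ old = Reach⇒predecessor t i old i≢r
    ... | inj₂ new = let j , q = orAll-true⁻ _ new in j , proj₂ (∧-true⁻ (Reach E r t j) q)

    Reach-isolatedRoot : (∀ j → E r j ≡ false) → ∀ t i → Reach E r t i ≡ true → i ≡ r
    Reach-isolatedRoot isolated zero    i e = eqFin⇒≡ e
    Reach-isolatedRoot isolated (suc t) i e with ∨-true⁻ e
    ... | inj₁ old = Reach-isolatedRoot isolated t i old
    ... | inj₂ new with orAll-true⁻ _ new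
    ...   | j , q with ∧-true⁻ (Reach E r t j) q
    ...     | j∈ , Eji with Reach-isolatedRoot isolated t j j∈
    ...       | refl = ⊥-elim (false≢true (trans (sym (isolated i)) Eji))

    Reach-leaf⇒parent : ∀ ℓ p → ℓ ≢ r → (∀ i → E i ℓ ≡ true → i ≡ p) →
      ∀ t → Reach E r t ℓ ≡ true → Reach E r t p ≡ true
    Reach-leaf⇒parent ℓ p ℓ≢r parent zero    e = ⊥-elim (ℓ≢r (eqFin⇒≡ e))
    Reach-leaf⇒parent ℓ p ℓ≢r parent (suc t) e with ∨-true⁻ e
    ... | inj₁ old = Reach-step t p (Reach-leaf⇒parent ℓ p ℓ≢r parent t old)
    ... | inj₂ new with orAll-true⁻ _ new
    ...   | j , q with ∧-true⁻ (Reach E r t j) q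
    ...     | j∈ , Ejℓ with parent j Ejℓ
    ...       | refl = Reach-step t j j∈

  Reach-deleteLeaf : ∀ {N} (E E′ : Fin N → Fin N → Bool) {r ℓ p : Fin N} → ℓ ≢ r → p ≢ ℓ →
    (∀ i → E i ℓ ≡ true → i ≡ p) → (∀ j → E ℓ j ≡ true → j ≡ p) →
    (∀ i j → i ≢ ℓ → j ≢ ℓ → E′ i j ≡ E i j) →
    ∀ t i → Reach E r t i ≡ true → i ≢ ℓ → Reach E′ r t i ≡ true
  Reach-deleteLeaf E E′ ℓ≢r p≢ℓ inℓ outℓ same zero    i e i≢ℓ = e
  Reach-deleteLeaf E E′ {r} {ℓ} {p} ℓ≢r p≢ℓ inℓ outℓ same (suc t) i e i≢ℓ with ∨-true⁻ e
  ... | inj₁ old = Reach-step E′ r t i (Reach-deleteLeaf E E′ ℓ≢r p≢ℓ inℓ outℓ same t i old i≢ℓ)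
  ... | inj₂ new with orAll-true⁻ _ new
  ...   | j , q with ∧-true⁻ (Reach E r t j) q
  ...     | j∈ , Eji with j ≟ᶠ ℓ
  ...       | yes refl with outℓ i Eji
  ...         | refl = Reach-step E′ r t p
                         (Reach-deleteLeaf E E′ ℓ≢r p≢ℓ inℓ outℓ same t p (Reach-leaf⇒parent E r ℓ p ℓ≢r inℓ t j∈) p≢ℓ)
  Reach-deleteLeaf E E′ {r} ℓ≢r p≢ℓ inℓ outℓ same (suc t) i e i≢ℓ | inj₂ new | j , q | j∈ , Eji | no j≢ℓ =
    subst (λ z → (Reach E′ r t i ∨ z) ≡ true)
      (sym (orAll-true⁺ _ j (cong₂ _∧_ (Reach-deleteLeaf E E′ ℓ≢r p≢ℓ inℓ outℓ same t j j∈ j≢ℓ)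
                                       (trans (same j i j≢ℓ i≢ℓ) Eji))))
      (∨-zeroʳ (Reach E′ r t i))

  module LeafExists {N} {H : Graph N} {k t r S E} (T : RootedTree H (suc (suc k)) t r S E) where
    open RootedTree T

    isLeaf : Fin N → Bool
    isLeaf i = S i ∧ (not (eqFin i r) ∧ (countFin (E i) ≤ᵇ 1))

    degree≥1 : ∀ i → S i ≡ true → i ≢ r → 1 ≤ countFin (E i)
    degree≥1 i Si i≢r =
      let j , Eji = Reach⇒predecessor E r t i (reachable i Si) i≢r in countFin-≥1 (E i) j (edge-sym j i Eji)

    rootDegree≥1 : 1 ≤ countFin (E r)
    rootDegree≥1 with searchFin (E r)
    ... | inj₁ (j , Erj) = countFin-≥1 (E r) j Erj
    ... | inj₂ isolated  = ⊥-elim (2+k≰1 (≤-trans (≤-reflexive (sym size)) onlyRoot))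
      where
      2+k≰1 : suc (suc k) ≤ 1 → ⊥
      2+k≰1 (s≤s ())
      onlyRoot : countFin S ≤ 1
      onlyRoot = ≤-trans (countFin-mono S (λ i → true ∧ eqFin i r)
                            (λ i Si → subst (λ x → eqFin x r ≡ true)
                                        (sym (Reach-isolatedRoot E r isolated t i (reachable i Si))) (eqFin-refl r)))
                         (≤-reflexive (countFin-singleton true r))

    -- Without a leaf the degree sum would be at least 1 + 2(k+1), yet it is 2(k+1).
    leafExists : ∃ λ ℓ → S ℓ ≡ true × ℓ ≢ r × countFin (E ℓ) ≡ 1
    leafExists with searchFin isLeaf
    ... | inj₁ (ℓ , leaf) =
      let Sℓ , rest = ∧-true⁻ (S ℓ) leaf
          ℓ≠r , deg≤1 = ∧-true⁻ (not (eqFin ℓ r)) rest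
          ℓ≢r = not-eqFin⁻ ℓ≠r
      in ℓ , Sℓ , ℓ≢r , ≤-antisym (≤ᵇ⇒≤ _ 1 (Equivalence.from T-≡ deg≤1)) (degree≥1 ℓ Sℓ ℓ≢r)
    ... | inj₂ noLeaf = ⊥-elim (<⇒≱ degreeSum< (sumFin-mono lowerBound deg lowerBound≤deg))
      where
      deg : Fin N → ℕ
      deg i = countFin (E i)
      lowerBound : Fin N → ℕ
      lowerBound i = iverson (S i) + iverson (erase S r i)
      sumLowerBound : sumFin lowerBound ≡ suc (suc k) + suc k
      sumLowerBound = trans (sumFin-+ (λ i → iverson (S i)) (λ i → iverson (erase S r i)))
        (cong₂ _+_ (trans (sumFin-iverson S) size)
                   (trans (sumFin-iverson (erase S r)) (suc-injective (trans (sym (countFin-erase S r root∈)) size))))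
      degreeSum< : sumFin deg < sumFin lowerBound
      degreeSum< rewrite edgeCount | sumLowerBound = s≤s (≤-reflexive (cong (suc k +_) (+-identityʳ (suc k))))
      lowerBound≤deg : ∀ i → lowerBound i ≤ deg i
      lowerBound≤deg i with S i in Si | eqFin-cases i r
      ... | false | _                 = z≤n
      ... | true  | inj₁ (refl , e) rewrite e = rootDegree≥1
      ... | true  | inj₂ (i≢r , e) rewrite e with deg i ≤? 1
      ...   | no  deg≰1 = ≰⇒> deg≰1
      ...   | yes deg≤1 = ⊥-elim (false≢true (trans (sym (noLeaf i)) isLeaf-i))
        where
        isLeaf-i : isLeaf i ≡ true
        isLeaf-i rewrite Si | e = Equivalence.to T-≡ (≤⇒≤ᵇ deg≤1)

  module RemoveLeaf {N} {H : Graph N} (loopless : ∀ i → H i i ≡ false)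
                    {k t r S E} (T : RootedTree H (suc (suc k)) t r S E) where
    open RootedTree T
    open LeafExists T using (leafExists)

    ℓ : Fin N
    ℓ = proj₁ leafExists

    Sℓ : S ℓ ≡ true
    Sℓ = proj₁ (proj₂ leafExists)

    ℓ≢r : ℓ ≢ r
    ℓ≢r = proj₁ (proj₂ (proj₂ leafExists))

    degℓ : countFin (E ℓ) ≡ 1
    degℓ = proj₂ (proj₂ (proj₂ leafExists))

    p : Fin N
    p = proj₁ (countFin-witness (E ℓ) (≤-reflexive (sym degℓ)))

    Eℓp : E ℓ p ≡ true
    Eℓp = proj₂ (countFin-witness (E ℓ) (≤-reflexive (sym degℓ)))

    outℓ : ∀ j → E ℓ j ≡ true → j ≡ p
    outℓ j Eℓj = countFin≡1⇒unique (E ℓ) degℓ j p Eℓj Eℓp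

    inℓ : ∀ i → E i ℓ ≡ true → i ≡ p
    inℓ i Eiℓ = outℓ i (edge-sym i ℓ Eiℓ)

    Hpℓ : H p ℓ ≡ true
    Hpℓ = proj₁ (edge⇒adjacent p ℓ (edge-sym ℓ p Eℓp))

    p≢ℓ : p ≢ ℓ
    p≢ℓ p≡ℓ = false≢true (trans (sym (loopless ℓ)) (subst (λ x → H x ℓ ≡ true) p≡ℓ Hpℓ))

    S′ : Fin N → Bool
    S′ = erase S ℓ

    E′ : Fin N → Fin N → Bool
    E′ i j = E i j ∧ (not (eqFin i ℓ) ∧ not (eqFin j ℓ))

    p∈S′ : S′ p ≡ true
    p∈S′ = cong₂ _∧_ (proj₂ (proj₂ (edge⇒adjacent ℓ p Eℓp))) (not-eqFin p≢ℓ)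

    S-split : ∀ i → S i ≡ (S′ i ∨ eqFin i ℓ)
    S-split i with eqFin-cases i ℓ
    ... | inj₁ (refl , e) rewrite e = trans Sℓ (sym (∨-zeroʳ _))
    ... | inj₂ (_ , e)    rewrite e = sym (trans (∨-identityʳ _) (∧-identityʳ (S i)))

    private
      absent : ∀ {x} → (x ≡ true → ⊥) → x ≡ ((x ∧ false) ∨ false)
      absent {true}  x≢true = ⊥-elim (x≢true refl)
      absent {false} _      = refl

    E-split : ∀ a b → E a b ≡ (E′ a b ∨ ((eqFin a p ∧ eqFin b ℓ) ∨ (eqFin a ℓ ∧ eqFin b p)))
    E-split a b with eqFin-cases a ℓ | eqFin-cases b ℓ
    ... | inj₁ (refl , ea) | _ rewrite ea | ≢⇒eqFin-false (λ (e : a ≡ p) → p≢ℓ (sym e)) with eqFin-cases b p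
    ...   | inj₁ (refl , eb) rewrite Eℓp | eb = refl
    ...   | inj₂ (b≢p , eb)  rewrite eb = absent (λ Eab → b≢p (outℓ b Eab))
    E-split a b | inj₂ (_ , ea) | inj₁ (refl , eb) rewrite eb | ea with eqFin-cases a p
    ...   | inj₁ (refl , e)  rewrite edge-sym b a Eℓp | e = refl
    ...   | inj₂ (a≢p , e)   rewrite e = absent (λ Eab → a≢p (inℓ a Eab))
    E-split a b | inj₂ (_ , ea) | inj₂ (_ , eb) rewrite ea | eb with E a b | eqFin a p
    ...   | true  | _     = refl
    ...   | false | true  = refl
    ...   | false | false = refl

    rowCount : ∀ i → countFin (E i) ≡ countFin (E′ i) + (iverson (eqFin i p) + iverson (eqFin i ℓ))
    rowCount i =
      trans (countFin-cong (E i) _ (E-split i))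
        (trans (countFin-∨-disjoint (E′ i) _ new∉E′)
          (cong (countFin (E′ i) +_)
            (trans (countFin-∨-disjoint (λ b → eqFin i p ∧ eqFin b ℓ) (λ b → eqFin i ℓ ∧ eqFin b p) p≠ℓ)
                   (cong₂ _+_ (countFin-singleton (eqFin i p) ℓ) (countFin-singleton (eqFin i ℓ) p)))))
      where
      new∉E′ : ∀ b → E′ i b ≡ true → ((eqFin i p ∧ eqFin b ℓ) ∨ (eqFin i ℓ ∧ eqFin b p)) ≡ true → ⊥
      new∉E′ b E′ib new with ∧∧-true⁻ (E i b) _ E′ib | ∨-true⁻ new
      ... | _ , i≠ℓ , b≠ℓ | inj₁ pℓ = not-eqFin⁻ b≠ℓ (eqFin⇒≡ (proj₂ (∧-true⁻ (eqFin i p) pℓ)))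
      ... | _ , i≠ℓ , b≠ℓ | inj₂ ℓp = not-eqFin⁻ i≠ℓ (eqFin⇒≡ (proj₁ (∧-true⁻ (eqFin i ℓ) ℓp)))
      p≠ℓ : ∀ b → (eqFin i p ∧ eqFin b ℓ) ≡ true → (eqFin i ℓ ∧ eqFin b p) ≡ true → ⊥
      p≠ℓ b x y = p≢ℓ (trans (sym (eqFin⇒≡ (proj₁ (∧-true⁻ (eqFin i p) x)))) (eqFin⇒≡ (proj₁ (∧-true⁻ (eqFin i ℓ) y))))

    edgeCount′ : sumFin (λ i → countFin (E′ i)) ≡ 2 * k
    edgeCount′ = +-cancelʳ-≡ 2 _ _ (trans (sym removedTwo) (trans edgeCount (2*[2+k∸1]≡2*k+2 k)))
      where
      removedTwo : sumFin (λ i → countFin (E i)) ≡ sumFin (λ i → countFin (E′ i)) + 2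
      removedTwo =
        trans (sumFin-cong _ _ rowCount)
          (trans (sumFin-+ (λ i → countFin (E′ i)) _)
            (cong (sumFin (λ i → countFin (E′ i)) +_)
              (trans (sumFin-+ (λ i → iverson (eqFin i p)) (λ i → iverson (eqFin i ℓ)))
                (cong₂ _+_ (trans (sumFin-iverson (λ i → eqFin i p)) (countFin-singleton true p))
                           (trans (sumFin-iverson (λ i → eqFin i ℓ)) (countFin-singleton true ℓ))))))
      2*[2+k∸1]≡2*k+2 : ∀ k → 2 * (suc (suc k) ∸ 1) ≡ 2 * k + 2
      2*[2+k∸1]≡2*k+2 k = trans (*-distribˡ-+ 2 1 k) (+-comm 2 (2 * k))

    E′≡E : ∀ i j → i ≢ ℓ → j ≢ ℓ → E′ i j ≡ E i j
    E′≡E i j i≢ℓ j≢ℓ rewrite ≢⇒eqFin-false i≢ℓ | ≢⇒eqFin-false j≢ℓ = ∧-identityʳ (E i j)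

    tree′ : RootedTree H (suc k) t r S′ E′
    tree′ = record
      { root∈         = cong₂ _∧_ root∈ (not-eqFin (λ e → ℓ≢r (sym e)))
      ; size          = suc-injective (trans (sym (countFin-erase S ℓ Sℓ)) size)
      ; edge⇒adjacent = λ i j e →
          let Eij , i≠ℓ , j≠ℓ = ∧∧-true⁻ (E i j) _ e
              Hij , Si , Sj = edge⇒adjacent i j Eij
          in Hij , cong₂ _∧_ Si i≠ℓ , cong₂ _∧_ Sj j≠ℓ
      ; edge-sym      = λ i j e →
          let Eij , i≠ℓ , j≠ℓ = ∧∧-true⁻ (E i j) (not (eqFin i ℓ)) e
          in cong₂ _∧_ (edge-sym i j Eij) (cong₂ _∧_ j≠ℓ i≠ℓ)
      ; edgeCount     = edgeCount′
      ; reachable     = λ i S′i → let Si , i≠ℓ = ∧-true⁻ (S i) S′i in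
          Reach-deleteLeaf E E′ ℓ≢r p≢ℓ inℓ outℓ E′≡E t i (reachable i Si) (not-eqFin⁻ i≠ℓ)
      }

module TreeCodes where

  open import Data.Bool using (Bool; true; false; _∧_; _∨_)
  open import Data.Bool.Properties using (∨-assoc; ∨-comm; ∨-identityʳ)
  open import Data.Nat
  open import Data.Nat.Properties
  open import Data.Fin using (Fin)
  open import Data.List using (List; []; _∷_; length; _++_)
  open import Data.Product using (∃; ∃₂; proj₁; proj₂)
  open import Data.Sum using (inj₁; inj₂)
  open import Data.Empty using (⊥-elim)
  open import Relation.Binary.PropositionalEquality
  open Counting
  open FinCounting
  open RootedTrees

  -- A depth-first traversal of a rooted tree: `down i` moves to the i-th neighbour of the current
  -- vertex, `up` returns to its parent. A tree on k+1 vertices is traversed by k downs and k ups.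
  data Step (Δ : ℕ) : Set where
    up   : Step Δ
    down : Fin Δ → Step Δ

  #downs : ∀ {Δ} → List (Step Δ) → ℕ
  #downs []           = 0
  #downs (up ∷ s)     = #downs s
  #downs (down _ ∷ s) = suc (#downs s)

  #downs-++ : ∀ {Δ} (s₁ s₂ : List (Step Δ)) → #downs (s₁ ++ s₂) ≡ #downs s₁ + #downs s₂
  #downs-++ []            s₂ = refl
  #downs-++ (up ∷ s₁)     s₂ = #downs-++ s₁ s₂
  #downs-++ (down _ ∷ s₁) s₂ = cong suc (#downs-++ s₁ s₂)

  shape : ∀ {Δ} → List (Step Δ) → List Bool
  shape []           = []
  shape (up ∷ s)     = false ∷ shape s
  shape (down _ ∷ s) = true ∷ shape s

  choices : ∀ {Δ} → List (Step Δ) → List (Fin Δ)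
  choices []           = []
  choices (up ∷ s)     = choices s
  choices (down i ∷ s) = i ∷ choices s

  zipSteps : ∀ {Δ} → List Bool → List (Fin Δ) → List (Step Δ)
  zipSteps []            _        = []
  zipSteps (false ∷ bs)  is       = up ∷ zipSteps bs is
  zipSteps (true  ∷ bs)  []       = up ∷ zipSteps bs []
  zipSteps (true  ∷ bs)  (i ∷ is) = down i ∷ zipSteps bs is

  zipSteps-shape-choices : ∀ {Δ} (s : List (Step Δ)) → zipSteps (shape s) (choices s) ≡ s
  zipSteps-shape-choices []           = refl
  zipSteps-shape-choices (up ∷ s)     = cong (up ∷_) (zipSteps-shape-choices s)
  zipSteps-shape-choices (down i ∷ s) = cong (down i ∷_) (zipSteps-shape-choices s)

  length-shape : ∀ {Δ} (s : List (Step Δ)) → length (shape s) ≡ length s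
  length-shape []           = refl
  length-shape (up ∷ s)     = cong suc (length-shape s)
  length-shape (down _ ∷ s) = cong suc (length-shape s)

  length-choices : ∀ {Δ} (s : List (Step Δ)) → length (choices s) ≡ #downs s
  length-choices []           = refl
  length-choices (up ∷ s)     = length-choices s
  length-choices (down _ ∷ s) = cong suc (length-choices s)

  module Traversal {N : ℕ} (Δ : ℕ) (nbr : Fin N → Fin Δ → Fin N) where

    -- The current vertex and the stack of its ancestors.
    State : Set
    State = Fin N × List (Fin N)

    push : Fin N → State → State
    push x (a , as) = (x , a ∷ as)

    pop : State → State
    pop (a , [])     = (a , [])
    pop (a , b ∷ as) = (b , as)

    next : State → Fin Δ → Fin N
    next (a , _) i = nbr a i

    run : State → List (Step Δ) → State
    run st []           = st
    run st (up ∷ s)     = run (pop st) s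
    run st (down i ∷ s) = run (push (next st i) st) s

    visited : State → List (Step Δ) → Fin N → Bool
    visited st []           v = false
    visited st (up ∷ s)     v = visited (pop st) s v
    visited st (down i ∷ s) v = eqFin v (next st i) ∨ visited (push (next st i) st) s v

    stepEdge : State → Fin Δ → Fin N → Fin N → Bool
    stepEdge st i a b = (eqFin a (proj₁ st) ∧ eqFin b (next st i)) ∨ (eqFin a (next st i) ∧ eqFin b (proj₁ st))

    traversed : State → List (Step Δ) → Fin N → Fin N → Bool
    traversed st []           a b = false
    traversed st (up ∷ s)     a b = traversed (pop st) s a b
    traversed st (down i ∷ s) a b = stepEdge st i a b ∨ traversed (push (next st i) st) s a b

    visited-++ : ∀ st s₁ s₂ v → visited st (s₁ ++ s₂) v ≡ (visited st s₁ v ∨ visited (run st s₁) s₂ v)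
    visited-++ st []            s₂ v = refl
    visited-++ st (up ∷ s₁)     s₂ v = visited-++ (pop st) s₁ s₂ v
    visited-++ st (down i ∷ s₁) s₂ v =
      trans (cong (eqFin v (next st i) ∨_) (visited-++ _ s₁ s₂ v)) (sym (∨-assoc (eqFin v (next st i)) _ _))

    traversed-++ : ∀ st s₁ s₂ a b → traversed st (s₁ ++ s₂) a b ≡ (traversed st s₁ a b ∨ traversed (run st s₁) s₂ a b)
    traversed-++ st []            s₂ a b = refl
    traversed-++ st (up ∷ s₁)     s₂ a b = traversed-++ (pop st) s₁ s₂ a b
    traversed-++ st (down i ∷ s₁) s₂ a b =
      trans (cong (stepEdge st i a b ∨_) (traversed-++ _ s₁ s₂ a b)) (sym (∨-assoc (stepEdge st i a b) _ _))

    visited⇒prefix : ∀ st s v → visited st s v ≡ true → ∃₂ λ s₁ s₂ → s ≡ s₁ ++ s₂ × proj₁ (run st s₁) ≡ v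
    visited⇒prefix st (up ∷ s) v e =
      let s₁ , s₂ , s≡ , at = visited⇒prefix (pop st) s v e in up ∷ s₁ , s₂ , cong (up ∷_) s≡ , at
    visited⇒prefix st (down i ∷ s) v e with ∨-true⁻ e
    ... | inj₁ here  = down i ∷ [] , s , refl , sym (eqFin⇒≡ here)
    ... | inj₂ later = let s₁ , s₂ , s≡ , at = visited⇒prefix _ s v later in down i ∷ s₁ , s₂ , cong (down i ∷_) s≡ , at

    treeVertices : Fin N → List (Step Δ) → Fin N → Bool
    treeVertices r s v = eqFin v r ∨ visited (r , []) s v

    treeEdges : Fin N → List (Step Δ) → Fin N → Fin N → Bool
    treeEdges r s = traversed (r , []) s

    record Encodes (r : Fin N) (S : Fin N → Bool) (E : Fin N → Fin N → Bool) (k : ℕ) : Set where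
      field
        word      : List (Step Δ)
        length≡   : length word ≡ 2 * k
        #downs≡   : #downs word ≡ k
        vertices≡ : ∀ v → S v ≡ treeVertices r word v
        edges≡    : ∀ a b → E a b ≡ treeEdges r word a b

    encodesRoot : ∀ {r S E} → (∀ v → S v ≡ eqFin v r) → (∀ a b → E a b ≡ false) → Encodes r S E 0
    encodesRoot S≡ E≡ = record
      { word = [] ; length≡ = refl ; #downs≡ = refl
      ; vertices≡ = λ v → trans (S≡ v) (sym (∨-identityʳ _)) ; edges≡ = E≡ }

    -- The new leaf ℓ hangs off p, which is reached after some prefix of the word; walking down to ℓ
    -- and back up there adds exactly ℓ and the edge pℓ.
    encodesAddLeaf : ∀ {r S′ E′ S E k p ℓ i} → Encodes r S′ E′ k → S′ p ≡ true → nbr p i ≡ ℓ →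
      (∀ v → S v ≡ (S′ v ∨ eqFin v ℓ)) →
      (∀ a b → E a b ≡ (E′ a b ∨ ((eqFin a p ∧ eqFin b ℓ) ∨ (eqFin a ℓ ∧ eqFin b p)))) →
      Encodes r S E (suc k)
    encodesAddLeaf {r} {S′} {E′} {S} {E} {k} {p} {ℓ} {i} code p∈S′ nbr≡ S≡ E≡ = record
      { word      = s₁ ++ down i ∷ up ∷ s₂
      ; length≡   = trans (length-insert s₁) (trans (cong (λ z → 2 + length z) (sym word≡))
                      (trans (cong (2 +_) length≡) (sym (*-suc 2 k))))
      ; #downs≡   = trans (#downs-++ s₁ (down i ∷ up ∷ s₂)) (trans (+-suc (#downs s₁) (#downs s₂))
                      (cong suc (trans (sym (#downs-++ s₁ s₂)) (trans (cong #downs (sym word≡)) #downs≡))))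
      ; vertices≡ = vertices
      ; edges≡    = edges
      }
      where
      open Encodes code
      st₀ : State
      st₀ = (r , [])
      prefix : ∃₂ λ s₁ s₂ → word ≡ s₁ ++ s₂ × proj₁ (run st₀ s₁) ≡ p
      prefix with eqFin-cases p r
      ... | inj₁ (p≡r , _) = [] , word , refl , sym p≡r
      ... | inj₂ (_ , e)   = visited⇒prefix st₀ word p (trans (sym (cong (_∨ visited st₀ word p) e))
                                                              (trans (sym (vertices≡ p)) p∈S′))
      s₁ = proj₁ prefix
      s₂ = proj₁ (proj₂ prefix)
      word≡ : word ≡ s₁ ++ s₂
      word≡ = proj₁ (proj₂ (proj₂ prefix))
      st₁ = run st₀ s₁
      at-p : proj₁ st₁ ≡ p
      at-p = proj₂ (proj₂ (proj₂ prefix))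
      next≡ℓ : next st₁ i ≡ ℓ
      next≡ℓ = trans (cong (λ z → nbr z i) at-p) nbr≡
      length-insert : ∀ (u : List (Step Δ)) {x y} → length (u ++ x ∷ y ∷ s₂) ≡ 2 + length (u ++ s₂)
      length-insert []      = refl
      length-insert (_ ∷ u) = cong suc (length-insert u)
      rearrange : ∀ a b c → ((a ∨ b) ∨ c) ≡ (a ∨ (c ∨ b))
      rearrange a b c = trans (∨-assoc a b c) (cong (a ∨_) (∨-comm b c))
      vertices : ∀ v → S v ≡ treeVertices r (s₁ ++ down i ∷ up ∷ s₂) v
      vertices v = begin
        S v                                                          ≡⟨ S≡ v ⟩
        S′ v ∨ eqFin v ℓ                                             ≡⟨ cong (_∨ eqFin v ℓ) (vertices≡ v) ⟩
        (eqFin v r ∨ visited st₀ word v) ∨ eqFin v ℓ                 ≡⟨ cong (λ z → (eqFin v r ∨ z) ∨ eqFin v ℓ)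
                                                                          (trans (cong (λ z → visited st₀ z v) word≡) (visited-++ st₀ s₁ s₂ v)) ⟩
        (eqFin v r ∨ (visited st₀ s₁ v ∨ visited st₁ s₂ v)) ∨ eqFin v ℓ ≡⟨ trans (∨-assoc (eqFin v r) _ _) (cong (eqFin v r ∨_) (rearrange (visited st₀ s₁ v) _ _)) ⟩
        eqFin v r ∨ (visited st₀ s₁ v ∨ (eqFin v ℓ ∨ visited st₁ s₂ v)) ≡⟨ cong (λ z → eqFin v r ∨ (visited st₀ s₁ v ∨ (eqFin v z ∨ visited st₁ s₂ v))) (sym next≡ℓ) ⟩
        eqFin v r ∨ (visited st₀ s₁ v ∨ visited st₁ (down i ∷ up ∷ s₂) v) ≡⟨ cong (eqFin v r ∨_) (sym (visited-++ st₀ s₁ (down i ∷ up ∷ s₂) v)) ⟩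
        treeVertices r (s₁ ++ down i ∷ up ∷ s₂) v                    ∎
        where open ≡-Reasoning
      newEdge : ∀ (st : State) a b → proj₁ st ≡ p → next st i ≡ ℓ →
        stepEdge st i a b ≡ ((eqFin a p ∧ eqFin b ℓ) ∨ (eqFin a ℓ ∧ eqFin b p))
      newEdge (_ , _) a b refl e rewrite e = refl
      edges : ∀ a b → E a b ≡ treeEdges r (s₁ ++ down i ∷ up ∷ s₂) a b
      edges a b = begin
        E a b                                                        ≡⟨ E≡ a b ⟩
        E′ a b ∨ new                                                 ≡⟨ cong (_∨ new) (trans (edges≡ a b)
                                                                          (trans (cong (λ z → traversed st₀ z a b) word≡) (traversed-++ st₀ s₁ s₂ a b))) ⟩
        (traversed st₀ s₁ a b ∨ traversed st₁ s₂ a b) ∨ new           ≡⟨ rearrange (traversed st₀ s₁ a b) _ _ ⟩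
        traversed st₀ s₁ a b ∨ (new ∨ traversed st₁ s₂ a b)           ≡⟨ cong (λ z → traversed st₀ s₁ a b ∨ (z ∨ traversed st₁ s₂ a b)) (sym (newEdge st₁ a b at-p next≡ℓ)) ⟩
        traversed st₀ s₁ a b ∨ traversed st₁ (down i ∷ up ∷ s₂) a b  ≡⟨ sym (traversed-++ st₀ s₁ (down i ∷ up ∷ s₂) a b) ⟩
        treeEdges r (s₁ ++ down i ∷ up ∷ s₂) a b                     ∎
        where
        open ≡-Reasoning
        new = (eqFin a p ∧ eqFin b ℓ) ∨ (eqFin a ℓ ∧ eqFin b p)

    module _ {H : Graph N} (loopless : ∀ i → H i i ≡ false)
             (nbr-onto : ∀ p ℓ → H p ℓ ≡ true → ∃ λ i → nbr p i ≡ ℓ) where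

      encodesSingleVertex : ∀ {t r S E} → RootedTree H 1 t r S E → Encodes r S E 0
      encodesSingleVertex {r = r} {S} {E} T = encodesRoot onlyRoot noEdge
        where
        open RootedTree T
        onlyRoot : ∀ v → S v ≡ eqFin v r
        onlyRoot v with eqFin-cases v r | S v in Sv
        ... | inj₁ (refl , e) | _     = trans (sym Sv) (trans root∈ (sym e))
        ... | inj₂ (_ , e)    | false = sym e
        ... | inj₂ (v≢r , _)  | true  = ⊥-elim (v≢r (countFin≡1⇒unique S size v r Sv root∈))
        noEdge : ∀ a b → E a b ≡ false
        noEdge a b with E a b in Eab
        ... | false = refl
        ... | true  = ⊥-elim (1+n≰n (≤-trans (countFin-≥1 (E a) b Eab)
                                      (≤-trans (sumFin-≥ (λ i → countFin (E i)) a) (≤-reflexive edgeCount))))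

      encode : ∀ k {t r S E} → RootedTree H (suc k) t r S E → Encodes r S E k
      encode zero    T = encodesSingleVertex T
      encode (suc k) T =
        encodesAddLeaf (encode k tree′) p∈S′ (proj₂ (nbr-onto p ℓ Hpℓ)) S-split E-split
        where open RemoveLeaf loopless T

module TreeCounting where

  open import Data.Bool using (Bool; true; false; _∧_; T)
  open import Data.Bool.Properties using (T-≡)
  open import Data.Nat
  open import Data.Nat.Properties
  open import Data.Nat.Tactic.RingSolver using (solve-∀)
  open import Data.Fin using (Fin; toℕ; fromℕ<)
  import Data.Fin.Properties as Fin
  open import Data.Fin.Subset using (Subset; ∣_∣)
  open import Data.Vec using (Vec; lookup; tabulate)
  import Data.Vec.Properties as Vec
  open import Data.List using (List; []; _∷_; map; concatMap; filterᵇ; length)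
  import Data.List as List
  import Data.List.Properties as List
  open import Data.List.Membership.Propositional using (_∈_)
  open import Data.List.Membership.Propositional.Properties using (∈-map⁺; ∈-map⁻; ∈-allFin)
  open import Data.List.Relation.Unary.Any using (here; there)
  open import Data.List.Relation.Unary.Unique.Propositional using (Unique)
  open import Data.List.Relation.Unary.Unique.Propositional.Properties using (allFin⁺)
  open import Data.Product using (∃; proj₁; proj₂)
  open import Data.Empty using (⊥; ⊥-elim)
  open import Function using (Equivalence)
  open import Relation.Binary.PropositionalEquality
  open Counting
  open Enumeration
  open FinCounting
  open Unfolding
  open RootedTrees
  open TreeCodes

  lookupOr : ∀ {A : Set} → List A → ℕ → A → A
  lookupOr []       n       d = d
  lookupOr (x ∷ xs) zero    d = x
  lookupOr (x ∷ xs) (suc n) d = lookupOr xs n d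

  lookupOr-∈ : ∀ {A : Set} {x : A} xs d → x ∈ xs → ∃ λ n → n < length xs × lookupOr xs n d ≡ x
  lookupOr-∈ (y ∷ xs) d (here refl) = 0 , s≤s z≤n , refl
  lookupOr-∈ (y ∷ xs) d (there m)   = let n , n< , e = lookupOr-∈ xs d m in suc n , s≤s n< , e

  ⇒ᵇ-true⁻ : ∀ {a b} → (a ⇒ᵇ b) ≡ true → a ≡ true → b ≡ true
  ⇒ᵇ-true⁻ {true} e refl = e

  ≡ᵇ-true⁻ : ∀ m n → (m ≡ᵇ n) ≡ true → m ≡ n
  ≡ᵇ-true⁻ m n e = ≡ᵇ⇒≡ m n (Equivalence.from T-≡ e)

  Candidate : ℕ → Set
  Candidate N = Fin N × Subset N × EdgeSet N

  length-allFin : ∀ N → length (List.allFin N) ≡ N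
  length-allFin N = List.length-tabulate {n = N} (λ i → i)

  module _ {N : ℕ} (H : Graph N) (loopless : ∀ i → H i i ≡ false) where

    Δ : ℕ
    Δ = maxDegree H

    neighbours : Fin N → List (Fin N)
    neighbours p = filterᵇ (H p) (List.allFin N)

    -- The i-th neighbour of p; out-of-range indices i ≥ degree p give the junk value p.
    nbr : Fin N → Fin Δ → Fin N
    nbr p i = lookupOr (neighbours p) (toℕ i) p

    nbr-onto : ∀ p ℓ → H p ℓ ≡ true → ∃ λ i → nbr p i ≡ ℓ
    nbr-onto p ℓ Hpℓ =
      let n , n< , e = lookupOr-∈ (neighbours p) p (∈-filterᵇ⁺ (H p) (∈-allFin ℓ) Hpℓ)
          n<Δ : n < Δ
          n<Δ = ≤-trans n< (≤-trans (≤-reflexive (trans (length-filterᵇ (H p) (List.allFin N))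
                   (trans (sym (countFin≡countᵇ (H p))) (sym (degree≡countFin H p))))) (degree≤maxDegree H p))
      in fromℕ< n<Δ , trans (cong (λ z → lookupOr (neighbours p) z p) (Fin.toℕ-fromℕ< n<Δ)) e

    edgeConditions : Subset N → EdgeSet N → Fin N → Fin N → Bool
    edgeConditions S E i j = (edgeAt E i j ⇒ᵇ (H i j ∧ lookup S i ∧ lookup S j)) ∧ (edgeAt E i j ⇒ᵇ edgeAt E j i)

    isRootedTree⇒RootedTree : ∀ k r S E → isRootedTree H k r S E ≡ true → RootedTree H k k r (lookup S) (edgeAt E)
    isRootedTree⇒RootedTree k r S E e =
      let r∈S , e₁         = ∧-true⁻ (lookup S r) e
          size , e₂        = ∧-true⁻ (∣ S ∣ ≡ᵇ k) e₁
          edgesOK , e₃     = ∧-true⁻ (andAll (λ i → andAll (edgeConditions S E i))) e₂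
          edges , connected = ∧-true⁻ (twiceEdges E ≡ᵇ 2 * (k ∸ 1)) e₃
          edgeOK i j       = ∧-true⁻ _ (andAll-true⁻ _ (andAll-true⁻ _ edgesOK i) j)
      in record
      { root∈         = r∈S
      ; size          = trans (sym (∣∣≡countFin S)) (≡ᵇ-true⁻ _ _ size)
      ; edge⇒adjacent = λ i j Eij →
          let Hij , Si , Sj = ∧∧-true⁻ (H i j) (lookup S i) (⇒ᵇ-true⁻ (proj₁ (edgeOK i j)) Eij)
          in Hij , Si , Sj
      ; edge-sym      = λ i j → ⇒ᵇ-true⁻ (proj₂ (edgeOK i j))
      ; edgeCount     = trans (sym (twiceEdges≡sumFin E)) (≡ᵇ-true⁻ _ _ edges)
      ; reachable     = λ i Si → trans (sym (lookup-reach E r k i)) (⇒ᵇ-true⁻ (andAll-true⁻ _ connected i) Si)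
      }

    open Traversal Δ nbr

    edgeSets : List (EdgeSet N)
    edgeSets = allVecsOf (allSubsets N) N

    candidates : List (Candidate N)
    candidates = concatMap (λ r → concatMap (λ S → map (λ E → (r , S , E)) edgeSets) (allSubsets N)) (List.allFin N)

    unique-candidates : Unique candidates
    unique-candidates =
      unique-concatMap _ (allFin⁺ N)
        (λ r _ → unique-concatMap _ (unique-allSubsets N)
          (λ S _ → unique-map _ (unique-allVecsOf (unique-allSubsets N) N) (λ { _ _ _ _ refl → refl }))
          (λ S S′ y _ _ yS yS′ →
             let _ , _ , e₁ = ∈-map⁻ (λ E → (r , S , E)) yS
                 _ , _ , e₂ = ∈-map⁻ (λ E → (r , S′ , E)) yS′
             in cong (λ c → proj₁ (proj₂ c)) (trans (sym e₁) e₂)))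
        (λ r r′ y _ _ yr yr′ →
           let S₁ , _ , k₁ = ∈-concatMap⁻ _ (allSubsets N) yr
               S₂ , _ , k₂ = ∈-concatMap⁻ _ (allSubsets N) yr′
               _ , _ , e₁ = ∈-map⁻ (λ E → (r , S₁ , E)) k₁
               _ , _ , e₂ = ∈-map⁻ (λ E → (r′ , S₂ , E)) k₂
           in cong proj₁ (trans (sym e₁) e₂))

    -- A code is a root, the shape (up/down pattern) of a traversal word, and its choices of neighbours.
    Code : Set
    Code = Fin N × List Bool × List (Fin Δ)

    codes : ℕ → List Code
    codes k = concatMap (λ r → concatMap (λ bs → map (λ is → (r , bs , is)) (allLists (List.allFin Δ) k))
                                          (allLists booleans (2 * k)))
                        (List.allFin N)

    length-codes : ∀ k → length (codes k) ≡ N * (2 ^ (2 * k) * Δ ^ k)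
    length-codes k =
      trans (length-concatMap _ (List.allFin N))
        (trans (sumMap-cong _ (λ _ → 2 ^ (2 * k) * Δ ^ k) (List.allFin N) (λ r _ → perRoot r))
          (trans (sumMap-const _ (List.allFin N)) (cong (_* (2 ^ (2 * k) * Δ ^ k)) (length-allFin N))))
      where
      #allFinLists : ∀ {M} m → length (allLists (List.allFin M) m) ≡ M ^ m
      #allFinLists {M} m = trans (length-allLists (List.allFin M) m) (cong (_^ m) (length-allFin M))
      perRoot : ∀ r → length (concatMap (λ bs → map (λ is → (r , bs , is)) (allLists (List.allFin Δ) k))
                                        (allLists booleans (2 * k))) ≡ 2 ^ (2 * k) * Δ ^ k
      perRoot r =
        trans (length-concatMap _ (allLists booleans (2 * k)))
          (trans (sumMap-cong _ (λ _ → Δ ^ k) (allLists booleans (2 * k))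
                   (λ bs _ → trans (List.length-map (λ is → (r , bs , is)) (allLists (List.allFin Δ) k)) (#allFinLists k)))
            (trans (sumMap-const (Δ ^ k) (allLists booleans (2 * k)))
              (cong (_* Δ ^ k) (length-allLists booleans (2 * k)))))

    decode : Code → Candidate N
    decode (r , bs , is) =
      let s = zipSteps bs is in (r , tabulate (treeVertices r s) , tabulate (λ a → tabulate (treeEdges r s a)))

    tree∈decodedCodes : ∀ k r S E → isRootedTree H (suc k) r S E ≡ true → (r , S , E) ∈ map decode (codes k)
    tree∈decodedCodes k r S E e = subst (_∈ map decode (codes k)) decode≡ (∈-map⁺ decode code∈)
      where
      code : Encodes r (lookup S) (edgeAt E) k
      code = encode loopless nbr-onto k (isRootedTree⇒RootedTree (suc k) r S E e)
      open Encodes code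
      code∈ : (r , shape word , choices word) ∈ codes k
      code∈ = ∈-concatMap⁺ _ (∈-allFin r)
                (∈-concatMap⁺ _ (subst (λ m → shape word ∈ allLists booleans m)
                                       (trans (length-shape word) length≡) (∈-allLists ∈-booleans (shape word)))
                  (∈-map⁺ _ (subst (λ m → choices word ∈ allLists (List.allFin Δ) m)
                                   (trans (length-choices word) #downs≡) (∈-allLists ∈-allFin (choices word)))))
      decode≡ : decode (r , shape word , choices word) ≡ (r , S , E)
      decode≡ rewrite zipSteps-shape-choices word =
        cong₂ (λ a b → (r , a , b))
          (trans (Vec.tabulate-cong (λ v → sym (vertices≡ v))) (Vec.tabulate∘lookup S))
          (trans (Vec.tabulate-cong (λ a → trans (Vec.tabulate-cong (λ b → sym (edges≡ a b)))
                                                 (Vec.tabulate∘lookup (lookup E a))))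
                 (Vec.tabulate∘lookup E))

    noEmptyTree : ∀ r S E → isRootedTree H 0 r S E ≡ true → ⊥
    noEmptyTree r S E e =
      let T = isRootedTree⇒RootedTree 0 r S E e in
      1+n≰n (≤-trans (countFin-≥1 _ r (RootedTree.root∈ T)) (≤-reflexive (RootedTree.size T)))

    #filteredTrees≤ : ∀ k (P : Candidate N → Bool) → (∀ r S E → P (r , S , E) ≡ true → isRootedTree H k r S E ≡ true) →
      length (filterᵇ P candidates) ≤ 4 ^ k * N * Δ ^ (k ∸ 1)
    #filteredTrees≤ zero    P P⇒tree = ≤-trans (Unique-⊆⇒length≤ {ys = []} (unique-filterᵇ P unique-candidates)
      (λ { (r , S , E) m → ⊥-elim (noEmptyTree r S E (P⇒tree r S E (proj₂ (∈-filterᵇ⁻ P candidates m)))) })) z≤n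
    #filteredTrees≤ (suc k) P P⇒tree =
      ≤-trans (Unique-⊆⇒length≤ (unique-filterᵇ P unique-candidates)
                (λ { (r , S , E) m → tree∈decodedCodes k r S E (P⇒tree r S E (proj₂ (∈-filterᵇ⁻ P candidates m))) }))
        (≤-trans (≤-reflexive (trans (List.length-map decode (codes k)) (length-codes k))) arithmetic)
      where
      arithmetic : N * (2 ^ (2 * k) * Δ ^ k) ≤ 4 ^ suc k * N * Δ ^ k
      arithmetic rewrite sym (^-*-assoc 2 2 k) =
        ≤-trans (≤-reflexive (reorder N (4 ^ k) (Δ ^ k)))
          (≤-trans (m≤n*m (4 ^ k * N * Δ ^ k) 4) (≤-reflexive (*-assoc-4 (4 ^ k) N (Δ ^ k))))
        where
        reorder : ∀ a b c → a * (b * c) ≡ b * a * c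
        reorder = solve-∀
        *-assoc-4 : ∀ b a c → 4 * (b * a * c) ≡ 4 * b * a * c
        *-assoc-4 = solve-∀

  numRootedTrees≤ : ∀ {N} (H : Graph N) → (∀ i → H i i ≡ false) →
    ∀ k → numRootedTrees H k ≤ 4 ^ k * N * maxDegree H ^ (k ∸ 1)
  numRootedTrees≤ H loopless k = #filteredTrees≤ H loopless k _ (λ r S E e → e)

module Paths where

  open import Data.Bool using (Bool; true; false; _∧_; _∨_; not)
  open import Data.Bool.Properties using (∧-identityʳ)
  open import Data.Unit using (⊤; tt)
  open import Data.Nat
  open import Data.Nat.Properties
  open import Data.Nat.Tactic.RingSolver using (solve-∀)
  open import Data.Fin using (Fin; zero; suc)
  open import Data.Vec using (Vec; []; _∷_; toList; fromList)
  import Data.Vec.Properties as VP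
  open import Data.List using (List; []; _∷_; length; _++_; reverse; map)
  import Data.List as L
  import Data.List.Properties as LP
  open import Data.List.Membership.Propositional using (_∈_; _∉_)
  open import Data.List.Membership.Propositional.Properties using (∈-++⁺ʳ; ∈-∃++)
  open import Data.List.Relation.Unary.Any using (here; there)
  import Data.List.Relation.Unary.Any.Properties as Any
  open import Data.List.Relation.Unary.Unique.Propositional using (Unique; [])
  import Data.List.Relation.Unary.Unique.Propositional.Properties as UniqueP
  open import Data.Product using (∃; ∃₂; proj₁; proj₂)
  open import Data.Sum using (_⊎_; inj₁; inj₂)
  open import Data.Empty using (⊥; ⊥-elim)
  open import Relation.Binary.PropositionalEquality
  open Counting
  open Enumeration
  open FinCounting
  open Unfolding

  memberᵇ : ∀ {n} → Fin n → List (Fin n) → Bool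
  memberᵇ x [] = false
  memberᵇ x (y ∷ ys) = eqFin x y ∨ memberᵇ x ys

  memberᵇ⇒∈ : ∀ {n} (x : Fin n) ys → memberᵇ x ys ≡ true → x ∈ ys
  memberᵇ⇒∈ x (y ∷ ys) e with ∨-true⁻ e
  ... | inj₁ a = here (eqFin⇒≡ {i = x} {j = y} a)
  ... | inj₂ b = there (memberᵇ⇒∈ x ys b)

  ∈⇒memberᵇ : ∀ {n} (x : Fin n) ys → x ∈ ys → memberᵇ x ys ≡ true
  ∈⇒memberᵇ x (y ∷ ys) (here refl) rewrite eqFin-refl x = refl
  ∈⇒memberᵇ x (y ∷ ys) (there m) rewrite ∈⇒memberᵇ x ys m = ∨-true' (eqFin x y)
    where
    ∨-true' : ∀ b → (b ∨ true) ≡ true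
    ∨-true' true = refl
    ∨-true' false = refl

  ∉⇒memberᵇ-false : ∀ {n} (x : Fin n) ys → x ∉ ys → memberᵇ x ys ≡ false
  ∉⇒memberᵇ-false x ys ne with memberᵇ x ys in e
  ... | true = ⊥-elim (ne (memberᵇ⇒∈ x ys e))
  ... | false = refl

  distinctᵇ : ∀ {n} → List (Fin n) → Bool
  distinctᵇ [] = true
  distinctᵇ (x ∷ xs) = not (memberᵇ x xs) ∧ distinctᵇ xs

  distinctᵇ⇒Unique : ∀ {n} (xs : List (Fin n)) → distinctᵇ xs ≡ true → Unique xs
  distinctᵇ⇒Unique [] e = []
  distinctᵇ⇒Unique (x ∷ xs) e with memberᵇ x xs in m
  ... | false = unique-∷ (λ k → false≢true (trans (sym m) (∈⇒memberᵇ x xs k))) (distinctᵇ⇒Unique xs e)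

  Unique⇒distinctᵇ : ∀ {n} (xs : List (Fin n)) → Unique xs → distinctᵇ xs ≡ true
  Unique⇒distinctᵇ [] u = refl
  Unique⇒distinctᵇ (x ∷ xs) u rewrite ∉⇒memberᵇ-false x xs (unique-head u) = Unique⇒distinctᵇ xs (unique-tail u)

  ∈-rev⁺ : ∀ {A : Set} {x : A} xs → x ∈ xs → x ∈ reverse xs
  ∈-rev⁺ xs m = Any.reverse⁺ m
  ∈-rev⁻ : ∀ {A : Set} {x : A} xs → x ∈ reverse xs → x ∈ xs
  ∈-rev⁻ xs m = Any.reverse⁻ m

  unique-snoc : ∀ {A : Set} (ys : List A) x → Unique ys → x ∉ ys → Unique (ys ++ x ∷ [])
  unique-snoc ys x u x∉ = UniqueP.++⁺ u (unique-∷ (λ ()) []) (λ { (y∈ , here refl) → x∉ y∈ })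

  unique-reverse : ∀ {A : Set} (xs : List A) → Unique xs → Unique (reverse xs)
  unique-reverse [] u = []
  unique-reverse (x ∷ xs) u rewrite LP.unfold-reverse x xs =
    unique-snoc (reverse xs) x (unique-reverse xs (unique-tail u)) (λ m → unique-head u (∈-rev⁻ xs m))

  module OnGraph {n} (G : Graph n) where
    adjacentᵇ : List (Fin n) → Bool
    adjacentᵇ [] = true
    adjacentᵇ (x ∷ []) = true
    adjacentᵇ (x ∷ y ∷ xs) = G x y ∧ adjacentᵇ (y ∷ xs)

    Adjacent : List (Fin n) → Set
    Adjacent [] = ⊤
    Adjacent (x ∷ []) = ⊤
    Adjacent (x ∷ y ∷ xs) = (G x y ≡ true) × Adjacent (y ∷ xs)

    adjacentᵇ⇒Adjacent : ∀ xs → adjacentᵇ xs ≡ true → Adjacent xs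
    adjacentᵇ⇒Adjacent [] e = tt
    adjacentᵇ⇒Adjacent (x ∷ []) e = tt
    adjacentᵇ⇒Adjacent (x ∷ y ∷ xs) e = let a , b = ∧-true⁻ (G x y) e in a , adjacentᵇ⇒Adjacent (y ∷ xs) b

    Adjacent⇒adjacentᵇ : ∀ xs → Adjacent xs → adjacentᵇ xs ≡ true
    Adjacent⇒adjacentᵇ [] c = refl
    Adjacent⇒adjacentᵇ (x ∷ []) c = refl
    Adjacent⇒adjacentᵇ (x ∷ y ∷ xs) (a , c) = cong₂ _∧_ a (Adjacent⇒adjacentᵇ (y ∷ xs) c)

    isPathᵇ : List (Fin n) → Bool
    isPathᵇ xs = distinctᵇ xs ∧ adjacentᵇ xs

    IsPath : List (Fin n) → Set
    IsPath xs = Unique xs × Adjacent xs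

    isPathᵇ⇒IsPath : ∀ xs → isPathᵇ xs ≡ true → IsPath xs
    isPathᵇ⇒IsPath xs e = let a , b = ∧-true⁻ (distinctᵇ xs) e in distinctᵇ⇒Unique xs a , adjacentᵇ⇒Adjacent xs b

    IsPath⇒isPathᵇ : ∀ xs → IsPath xs → isPathᵇ xs ≡ true
    IsPath⇒isPathᵇ xs (u , c) rewrite Unique⇒distinctᵇ xs u | Adjacent⇒adjacentᵇ xs c = refl

    Adjacent-++ˡ : ∀ xs ys → Adjacent (xs ++ ys) → Adjacent xs
    Adjacent-++ˡ [] ys c = tt
    Adjacent-++ˡ (x ∷ []) ys c = tt
    Adjacent-++ˡ (x ∷ y ∷ xs) ys (a , c) = a , Adjacent-++ˡ (y ∷ xs) ys c

    Adjacent-++ʳ : ∀ xs ys → Adjacent (xs ++ ys) → Adjacent ys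
    Adjacent-++ʳ [] ys c = c
    Adjacent-++ʳ (x ∷ []) [] c = tt
    Adjacent-++ʳ (x ∷ []) (y ∷ ys) (a , c) = c
    Adjacent-++ʳ (x ∷ y ∷ xs) ys (a , c) = Adjacent-++ʳ (y ∷ xs) ys c

    IsPath-++ˡ : ∀ xs ys → IsPath (xs ++ ys) → IsPath xs
    IsPath-++ˡ xs ys (u , c) = unique-++ˡ xs ys u , Adjacent-++ˡ xs ys c

    IsPath-++ʳ : ∀ xs ys → IsPath (xs ++ ys) → IsPath ys
    IsPath-++ʳ xs ys (u , c) = unique-++ʳ xs ys u , Adjacent-++ʳ xs ys c

    IsPath-tail : ∀ x xs → IsPath (x ∷ xs) → IsPath xs
    IsPath-tail x xs = IsPath-++ʳ (x ∷ []) xs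

  lastOr : ∀ {A : Set} → A → List A → A
  lastOr a [] = a
  lastOr a (b ∷ bs) = lastOr b bs

  lastOr-snoc : ∀ {A : Set} (a : A) mid b → lastOr a (mid ++ b ∷ []) ≡ b
  lastOr-snoc a [] b = refl
  lastOr-snoc a (x ∷ mid) b = lastOr-snoc x mid b

  module Conv {n} (G : Graph n) where
    open OnGraph G
    memᵇ≡memberᵇ : ∀ {m} (x : Fin n) (vs : Vec (Fin n) m) → memᵇ x vs ≡ memberᵇ x (toList vs)
    memᵇ≡memberᵇ x [] = refl
    memᵇ≡memberᵇ x (y ∷ vs) = cong (eqFin x y ∨_) (memᵇ≡memberᵇ x vs)

    allDistinct≡distinctᵇ : ∀ {m} (vs : Vec (Fin n) m) → allDistinct vs ≡ distinctᵇ (toList vs)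
    allDistinct≡distinctᵇ [] = refl
    allDistinct≡distinctᵇ (x ∷ vs) = cong₂ (λ a b → not a ∧ b) (memᵇ≡memberᵇ x vs) (allDistinct≡distinctᵇ vs)

    consecAdj≡adjacentᵇ : ∀ {m} (vs : Vec (Fin n) m) → consecAdj G vs ≡ adjacentᵇ (toList vs)
    consecAdj≡adjacentᵇ [] = refl
    consecAdj≡adjacentᵇ (x ∷ []) = refl
    consecAdj≡adjacentᵇ (x ∷ y ∷ vs) = cong (G x y ∧_) (consecAdj≡adjacentᵇ (y ∷ vs))

    isPath≡isPathᵇ : ∀ {m} (vs : Vec (Fin n) m) → isPath G vs ≡ isPathᵇ (toList vs)
    isPath≡isPathᵇ vs = cong₂ _∧_ (allDistinct≡distinctᵇ vs) (consecAdj≡adjacentᵇ vs)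

    lastV≡lastOr : ∀ {m} (a : Fin n) (vs : Vec (Fin n) m) → lastV (a ∷ vs) ≡ lastOr a (toList vs)
    lastV≡lastOr a [] = refl
    lastV≡lastOr a (b ∷ vs) = lastV≡lastOr b vs

  m+2≤l+1⇒2+[m+1]≤l+2 : ∀ m l → m + 2 ≤ l + 1 → suc (suc (m + 1)) ≤ l + 2
  m+2≤l+1⇒2+[m+1]≤l+2 m l h = subst₂ _≤_ (lhs m) (rhs l) (+-monoˡ-≤ 1 h)
    where
    lhs : ∀ m → m + 2 + 1 ≡ suc (suc (m + 1))
    lhs = solve-∀
    rhs : ∀ l → l + 1 + 1 ≡ l + 2
    rhs = solve-∀

  module LargeGirth {n} (G : Graph n) (Gsym : ∀ i j → G i j ≡ G j i) (Gloop : ∀ i → G i i ≡ false)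
                (l : ℕ) (girth : Girth≥ G (l + 2)) where
    open OnGraph G
    open Conv G

    noShortCycle : ∀ a mid b → IsPath (a ∷ mid ++ b ∷ []) → 1 ≤ length mid → length mid + 2 ≤ l + 1 → G b a ≡ true → ⊥
    noShortCycle a mid b P le1 le2 gba = false≢true (trans (sym gc) tc)
      where
      c = a ∷ mid ++ b ∷ []
      lenc : length c ≡ suc (length mid + 1)
      lenc = cong suc (LP.length-++ mid)
      gc = girth (length c) (subst (3 ≤_) (sym lenc) (s≤s (≤-trans (s≤s le1) (≤-reflexive (+-comm 1 (length mid))))))
                 (subst (_< l + 2) (sym lenc) (m+2≤l+1⇒2+[m+1]≤l+2 (length mid) l le2))
                 (fromList c)
      tc : isCycle G (fromList c) ≡ true
      tc = cong₂ _∧_ (trans (isPath≡isPathᵇ (fromList c)) (trans (cong isPathᵇ (VP.toList∘fromList c)) (IsPath⇒isPathᵇ c P)))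
                     (trans (cong (λ z → G z a) (trans (lastV≡lastOr a (fromList (mid ++ b ∷ [])))
                              (trans (cong (lastOr a) (VP.toList∘fromList (mid ++ b ∷ []))) (lastOr-snoc a mid b)))) gba)


    noChord : ∀ a y zs b → IsPath (a ∷ y ∷ zs) → b ∈ zs → length zs + 2 ≤ l + 1 → G a b ≡ true → ⊥
    noChord a y zs b P bm le gab =
      let pre , post , e = ∈-∃++ bm
          eq : a ∷ y ∷ zs ≡ (a ∷ (y ∷ pre) ++ b ∷ []) ++ post
          eq = cong (λ z → a ∷ y ∷ z) (trans e (sym (LP.++-assoc pre (b ∷ []) post)))
          P' = IsPath-++ˡ (a ∷ (y ∷ pre) ++ b ∷ []) post (subst IsPath eq P)
          lenle : length pre + 1 ≤ length zs
          lenle = subst (length pre + 1 ≤_) (sym (trans (cong length e) (LP.length-++ pre)))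
                     (+-monoʳ-≤ (length pre) (s≤s z≤n))
      in noShortCycle a (y ∷ pre) b P' (s≤s z≤n)
           (≤-trans (≤-reflexive (suc-m+2≡m+1+2 (length pre))) (≤-trans (+-monoˡ-≤ 2 lenle) le))
           (trans (Gsym b a) gab)
      where
      suc-m+2≡m+1+2 : ∀ m → suc m + 2 ≡ m + 1 + 2
      suc-m+2≡m+1+2 = solve-∀

    headSatisfies : (Fin n → Bool) → List (Fin n) → Bool
    headSatisfies ok [] = true
    headSatisfies ok (x ∷ _) = ok x

    headSatisfies-true : ∀ vs → headSatisfies (λ _ → true) vs ≡ true
    headSatisfies-true []      = refl
    headSatisfies-true (_ ∷ _) = refl

    notEq : Fin n → Fin n → Bool
    notEq v y = not (eqFin y v)

    IsPath-∷ : ∀ v x vs → length vs + 2 ≤ l + 1 → G v x ≡ true → IsPath (x ∷ vs) → headSatisfies (notEq v) vs ≡ true → IsPath (v ∷ x ∷ vs)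
    IsPath-∷ v x vs le gvx (u , c) h = unique-∷ (vnot vs le u c h) u , (gvx , c)
      where
      vnot : ∀ vs → length vs + 2 ≤ l + 1 → Unique (x ∷ vs) → Adjacent (x ∷ vs) → headSatisfies (notEq v) vs ≡ true → v ∉ x ∷ vs
      vnot vs le u c h (here refl) = false≢true (trans (sym (Gloop v)) gvx)
      vnot (y ∷ ys) le u c hh (there (here refl)) rewrite eqFin-refl v = false≢true hh
      vnot (y ∷ ys) le u c hh (there (there k)) = noChord x y ys v (u , c) k (≤-trans (≤-reflexive (+-comm (length ys) 2)) (≤-trans (n≤1+n _) (≤-trans (≤-reflexive (+-comm 2 (suc (length ys)))) le))) (trans (Gsym x v) gvx)

    IsPath-∷⁻ : ∀ v x vs → IsPath (v ∷ x ∷ vs) → (G v x ≡ true) × IsPath (x ∷ vs) × headSatisfies (notEq v) vs ≡ true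
    IsPath-∷⁻ v x vs (u , (gvx , c)) = gvx , (unique-tail u , c) , hd vs (λ m → unique-head u (there m))
      where
      hd : ∀ ws → v ∉ ws → headSatisfies (notEq v) ws ≡ true
      hd [] _ = refl
      hd (y ∷ ws) ne rewrite ≢⇒eqFin-false {i = y} {j = v} (λ e → ne (here (sym e))) = refl

    isPathᵇ-∷ : ∀ v x vs → length vs + 2 ≤ l + 1 →
      isPathᵇ (v ∷ x ∷ vs) ≡ (G v x ∧ (isPathᵇ (x ∷ vs) ∧ headSatisfies (notEq v) vs))
    isPathᵇ-∷ v x vs le = bool-ext
      (λ e → let a , b , c = IsPath-∷⁻ v x vs (isPathᵇ⇒IsPath (v ∷ x ∷ vs) e) in
         cong₂ _∧_ a (cong₂ _∧_ (IsPath⇒isPathᵇ (x ∷ vs) b) c))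
      (λ e → let a , bc = ∧-true⁻ (G v x) e
                 b , c = ∧-true⁻ (isPathᵇ (x ∷ vs)) bc
             in IsPath⇒isPathᵇ (v ∷ x ∷ vs) (IsPath-∷ v x vs le a (isPathᵇ⇒IsPath (x ∷ vs) b) c))

    lists : ℕ → List (List (Fin n))
    lists m = allLists (L.allFin n) m

    ∈-lists⇒length : ∀ m vs → vs ∈ lists m → length vs ≡ m
    ∈-lists⇒length m vs k = ∈-allLists⇒length (L.allFin n) m k

    #extensions : ℕ → Fin n → (Fin n → Bool) → ℕ
    #extensions m v ok = countᵇ (λ vs → isPathᵇ (v ∷ vs) ∧ headSatisfies ok vs) (lists m)

    #extensions-suc : ∀ m → suc m ≤ l → ∀ v ok → #extensions (suc m) v ok ≡ sumMap (λ x → iverson (G v x ∧ ok x) * #extensions m x (notEq v)) (L.allFin n)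
    #extensions-suc m le v ok =
      trans (countᵇ-concatMap P (λ x → map (x ∷_) (lists m)) (L.allFin n))
        (sumMap-cong _ _ (L.allFin n) (λ x _ →
          trans (countᵇ-map P (x ∷_) (lists m))
            (trans (countᵇ-cong _ (λ vs → (G v x ∧ (isPathᵇ (x ∷ vs) ∧ headSatisfies (notEq v) vs)) ∧ ok x) (lists m)
                     (λ vs k → cong (_∧ ok x) (isPathᵇ-∷ v x vs (≤-trans (≤-reflexive (cong (_+ 2) (∈-lists⇒length m vs k)))
                                                                (≤-trans (≤-reflexive (+-comm m 2)) (≤-trans (s≤s le) (≤-reflexive (+-comm 1 l))))))))
              (countᵇ-∧-const (G v x) (ok x) (λ vs → isPathᵇ (x ∷ vs) ∧ headSatisfies (notEq v) vs) (lists m)))))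
      where
      P : List (Fin n) → Bool
      P vs = isPathᵇ (v ∷ vs) ∧ headSatisfies ok vs

    module RegularCount (d : ℕ) (reg : Regular d G) where
      degree≡d : ∀ v → countᵇ (G v) (L.allFin n) ≡ d
      degree≡d v = trans (sym (countFin≡countᵇ (G v))) (trans (sym (degree≡countFin G v)) (reg v))

      degreeExcept≡d∸1 : ∀ v w → G v w ≡ true → countᵇ (erase (G v) w) (L.allFin n) ≡ d ∸ 1
      degreeExcept≡d∸1 v w Gvw = begin
        countᵇ (erase (G v) w) (L.allFin n)  ≡⟨ sym (countFin≡countᵇ (erase (G v) w)) ⟩
        suc (countFin (erase (G v) w)) ∸ 1   ≡⟨ cong (_∸ 1) (sym (countFin-erase (G v) w Gvw)) ⟩
        countFin (G v) ∸ 1                   ≡⟨ cong (_∸ 1) (trans (sym (degree≡countFin G v)) (reg v)) ⟩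
        d ∸ 1                                ∎
        where open ≡-Reasoning

      #extensions-avoiding : ∀ m → m ≤ l → ∀ v w → G v w ≡ true → #extensions m v (notEq w) ≡ (d ∸ 1) ^ m
      #extensions-avoiding zero le v w gvw = refl
      #extensions-avoiding (suc m) le v w gvw =
        trans (#extensions-suc m le v (notEq w))
          (trans (sumMap-cong _ (λ x → iverson (G v x ∧ notEq w x) * (d ∸ 1) ^ m) (L.allFin n) (λ x _ → subcount x))
            (trans (sumMap-iverson-* (λ x → G v x ∧ notEq w x) ((d ∸ 1) ^ m) (L.allFin n)) (cong (_* (d ∸ 1) ^ m) (degreeExcept≡d∸1 v w gvw))))
        where
        subcount : ∀ x → iverson (G v x ∧ notEq w x) * #extensions m x (notEq v) ≡ iverson (G v x ∧ notEq w x) * (d ∸ 1) ^ m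
        subcount x with G v x in gvx
        ... | false = refl
        ... | true = cong (iverson (notEq w x) *_) (#extensions-avoiding m (≤-trans (n≤1+n m) le) x v (trans (Gsym x v) gvx))

      #extensions-free : ∀ m → suc m ≤ l → ∀ v → #extensions (suc m) v (λ _ → true) ≡ d * (d ∸ 1) ^ m
      #extensions-free m le v =
        trans (#extensions-suc m le v (λ _ → true))
          (trans (sumMap-cong _ (λ x → iverson (G v x ∧ true) * (d ∸ 1) ^ m) (L.allFin n) (λ x _ → subcount x))
            (trans (sumMap-iverson-* (λ x → G v x ∧ true) ((d ∸ 1) ^ m) (L.allFin n))
              (cong (_* (d ∸ 1) ^ m) (trans (countᵇ-cong (λ x → G v x ∧ true) (G v) (L.allFin n) (λ x _ → ∧-identityʳ (G v x))) (degree≡d v)))))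
        where
        subcount : ∀ x → iverson (G v x ∧ true) * #extensions m x (notEq v) ≡ iverson (G v x ∧ true) * (d ∸ 1) ^ m
        subcount x with G v x in gvx
        ... | false = refl
        ... | true = cong (1 *_) (#extensions-avoiding m (≤-trans (n≤1+n m) le) x v (trans (Gsym x v) gvx))

    Adjacent-snoc : ∀ zs y x → Adjacent (zs ++ y ∷ []) → G y x ≡ true → Adjacent ((zs ++ y ∷ []) ++ x ∷ [])
    Adjacent-snoc [] y x c g = g , tt
    Adjacent-snoc (z ∷ []) y x (a , c) g = a , g , tt
    Adjacent-snoc (z ∷ z' ∷ zs) y x (a , c) g = a , Adjacent-snoc (z' ∷ zs) y x c g

    Adjacent-reverse : ∀ xs → Adjacent xs → Adjacent (reverse xs)
    Adjacent-reverse [] c = tt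
    Adjacent-reverse (x ∷ []) c = tt
    Adjacent-reverse (x ∷ y ∷ ys) (g , c) =
      subst Adjacent (sym e) (Adjacent-snoc (reverse ys) y x (subst Adjacent (LP.unfold-reverse y ys) (Adjacent-reverse (y ∷ ys) c)) (trans (Gsym y x) g))
      where
      e : reverse (x ∷ y ∷ ys) ≡ (reverse ys ++ y ∷ []) ++ x ∷ []
      e = trans (LP.unfold-reverse x (y ∷ ys)) (cong (_++ x ∷ []) (LP.unfold-reverse y ys))

    IsPath-reverse : ∀ xs → IsPath xs → IsPath (reverse xs)
    IsPath-reverse xs (u , c) = unique-reverse xs u , Adjacent-reverse xs c

    splitLast : ∀ (x : Fin n) xs → ∃₂ λ ys y → x ∷ xs ≡ ys ++ y ∷ []
    splitLast x [] = [] , x , refl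
    splitLast x (x' ∷ xs) = let ys , y , e = splitLast x' xs in x ∷ ys , y , cong (x ∷_) e

    neighbourOfHead : ∀ a b p'' x → IsPath (a ∷ b ∷ p'') → length p'' + 2 ≤ l + 1 → x ∈ a ∷ b ∷ p'' → G a x ≡ true → x ≡ b
    neighbourOfHead a b p'' x P le (here refl) g = ⊥-elim (false≢true (trans (sym (Gloop a)) g))
    neighbourOfHead a b p'' x P le (there (here refl)) g = refl
    neighbourOfHead a b p'' x P le (there (there m)) g = ⊥-elim (noChord a b p'' x P m le g)

    onlyNeighbourInPath : ∀ a p {u w} → IsPath (a ∷ p) → length p ≤ l →
      u ∈ a ∷ p → w ∈ a ∷ p → G a u ≡ true → G a w ≡ true → u ≡ w
    onlyNeighbourInPath a []       P le (here refl) _ Gau _ = ⊥-elim (false≢true (trans (sym (Gloop a)) Gau))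
    onlyNeighbourInPath a (b ∷ p″) P le u∈ w∈ Gau Gaw =
      trans (neighbourOfHead a b p″ _ P le′ u∈ Gau) (sym (neighbourOfHead a b p″ _ P le′ w∈ Gaw))
      where
      le′ : length p″ + 2 ≤ l + 1
      le′ = subst (_≤ l + 1) (sym (+-suc (length p″) 1)) (+-monoˡ-≤ 1 le)

    sameVertices⇒≡ : ∀ a p' q' → IsPath (a ∷ p') → IsPath (a ∷ q') → length p' ≡ length q' → length p' + 1 ≤ l + 1 →
      (∀ v → v ∈ a ∷ p' → v ∈ a ∷ q') → (∀ v → v ∈ a ∷ q' → v ∈ a ∷ p') → p' ≡ q'
    sameVertices⇒≡ a [] [] P Q le1 le2 f g = refl
    sameVertices⇒≡ a (b ∷ p'') (c ∷ q'') P Q le1 le2 f g with g c (there (here refl))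
    ... | here refl = ⊥-elim (proj₁ (uniqHd Q) (here refl))
      where
      uniqHd : ∀ {x xs} → IsPath (x ∷ xs) → x ∉ xs × Unique xs
      uniqHd (u , _) = unique-head u , unique-tail u
    ... | there (there m) = ⊥-elim (noChord a b p'' c P m le (proj₁ (proj₂ Q)))
      where
      le : length p'' + 2 ≤ l + 1
      le = ≤-trans (≤-reflexive (+-suc (length p'') 1)) le2
    ... | there (here refl) =
      cong (b ∷_) (sameVertices⇒≡ b p'' q'' (IsPath-tail a (b ∷ p'') P) (IsPath-tail a (b ∷ q'') Q) (suc-injective le1)
        (≤-trans (≤-reflexive (+-comm (length p'') 1)) (≤-trans (n≤1+n _) (≤-trans (≤-reflexive (+-comm 1 (suc (length p'')))) le2)))
        (λ v m → drop v (f v (there m)) (notA P m))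
        (λ v m → drop v (g v (there m)) (notA Q m)))
      where
      notA : ∀ {xs v} → IsPath (a ∷ xs) → v ∈ xs → v ≢ a
      notA (u , _) m refl = unique-head u m
      drop : ∀ {xs} v → v ∈ a ∷ xs → v ≢ a → v ∈ xs
      drop v (here refl) ne = ⊥-elim (ne refl)
      drop v (there m) ne = m

    sameVertices⇒≡-or-reverse : ∀ p q → IsPath p → IsPath q → length p ≡ length q → length p ≤ l + 1 →
      (∀ v → v ∈ p → v ∈ q) → (∀ v → v ∈ q → v ∈ p) → q ≡ p ⊎ q ≡ reverse p
    sameVertices⇒≡-or-reverse [] [] P Q le1 le2 f g = inj₁ refl
    sameVertices⇒≡-or-reverse [] (x ∷ q) P Q () le2 f g
    sameVertices⇒≡-or-reverse (a ∷ p') q P Q le1 le2 f g with ∈-∃++ (f a (here refl))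
    ... | [] , q2 , refl = inj₁ (cong (a ∷_) (sym (sameVertices⇒≡ a p' q2 P Q (suc-injective le1) (≤-trans (≤-reflexive (+-comm (length p') 1)) le2) f g)))
    ... | x ∷ q1 , [] , refl = inj₂ (trans (sym (LP.reverse-involutive _)) (cong reverse rq≡p))
      where
      rq : reverse ((x ∷ q1) ++ a ∷ []) ≡ a ∷ reverse (x ∷ q1)
      rq = LP.reverse-++ (x ∷ q1) (a ∷ [])
      Q' : IsPath (a ∷ reverse (x ∷ q1))
      Q' = subst IsPath rq (IsPath-reverse _ Q)
      lenq : length ((x ∷ q1) ++ a ∷ []) ≡ suc (length (reverse (x ∷ q1)))
      lenq = trans (LP.length-++ (x ∷ q1)) (trans (+-comm _ 1) (cong suc (sym (LP.length-reverse (x ∷ q1)))))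
      rq≡p : reverse ((x ∷ q1) ++ a ∷ []) ≡ a ∷ p'
      rq≡p = trans rq (cong (a ∷_) (sym (sameVertices⇒≡ a p' (reverse (x ∷ q1)) P Q'
                (suc-injective (trans le1 lenq)) (≤-trans (≤-reflexive (+-comm (length p') 1)) le2)
                (λ v m → subst (v ∈_) rq (∈-rev⁺ _ (f v m)))
                (λ v m → g v (∈-rev⁻ _ (subst (v ∈_) (sym rq) m))))))
    ... | x ∷ q1 , w ∷ q2 , refl =
      ⊥-elim (u≢w (onlyNeighbourInPath a p' P (≤-pred (subst (length (a ∷ p') ≤_) (+-comm l 1) le2)) u∈ w∈ (trans (Gsym a u) Gua) Gaw))
      where
      il = splitLast x q1
      q1' = proj₁ il
      u = proj₁ (proj₂ il)
      qeq : (x ∷ q1) ++ a ∷ w ∷ q2 ≡ q1' ++ u ∷ a ∷ w ∷ q2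
      qeq = trans (cong (_++ a ∷ w ∷ q2) (proj₂ (proj₂ il))) (LP.++-assoc q1' (u ∷ []) (a ∷ w ∷ q2))
      Q' : IsPath (u ∷ a ∷ w ∷ q2)
      Q' = IsPath-++ʳ q1' _ (subst IsPath qeq Q)
      Gua : G u a ≡ true
      Gua = proj₁ (proj₂ Q')
      Gaw : G a w ≡ true
      Gaw = proj₁ (proj₂ (proj₂ Q'))
      u≢w : u ≢ w
      u≢w refl = unique-head (proj₁ Q') (there (here refl))
      u∈ : u ∈ a ∷ p'
      u∈ = g u (subst (u ∈_) (sym qeq) (∈-++⁺ʳ q1' (here refl)))
      w∈ : w ∈ a ∷ p'
      w∈ = g w (∈-++⁺ʳ (x ∷ q1) (there (here refl)))

module Walks where

  open import Data.Bool using (Bool; true; false; _∧_; _∨_)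
  open import Data.Bool.Properties using (T-≡; ∧-identityʳ; ∨-zeroʳ)
  open import Data.Nat
  open import Data.Nat.Properties
  open import Data.Nat.DivMod using (_/_; m*n/n≡m)
  open import Data.Fin using (Fin) renaming (_≟_ to _≟ᶠ_)
  open import Data.Fin.Subset using (Subset; ⁅_⁆; _∪_)
  open import Data.Vec using (Vec; []; _∷_; toList; lookup)
  import Data.Vec as Vec
  import Data.Vec.Properties as VP
  open import Data.List using (List; []; _∷_; length; reverse; map)
  import Data.List as L
  import Data.List.Properties as LP
  open import Data.Bool.ListAction using (any)
  import Data.Bool.ListAction
  open import Data.List.Membership.Propositional using (_∈_)
  open import Data.List.Membership.Propositional.Properties using (∈-allFin)
  open import Data.List.Relation.Unary.Any using (here)
  open import Data.List.Relation.Unary.Unique.Propositional using (Unique)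
  open import Data.Product using (∃; ∃₂; proj₁; proj₂)
  open import Data.Sum using (inj₁; inj₂)
  open import Data.Empty using (⊥-elim)
  open import Function using (Equivalence; case_of_)
  open import Relation.Binary.PropositionalEquality
  open import Relation.Nullary.Decidable using (⌊_⌋; toWitness; fromWitness)
  open Counting
  open Enumeration
  open FinCounting
  open Unfolding
  open Paths

  vsetᴸ : ∀ {n} → List (Fin n) → Subset n
  vsetᴸ {n} q = L.foldr (λ x s → ⁅ x ⁆ ∪ s) (Vec.replicate n false) q

  vset≡vsetᴸ : ∀ {n m} (vs : Vec (Fin n) m) → vset vs ≡ vsetᴸ (toList vs)
  vset≡vsetᴸ [] = refl
  vset≡vsetᴸ (x ∷ vs) = cong (⁅ x ⁆ ∪_) (vset≡vsetᴸ vs)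

  lookup-vsetᴸ : ∀ {n} (q : List (Fin n)) x → lookup (vsetᴸ q) x ≡ memberᵇ x q
  lookup-vsetᴸ [] x = VP.lookup-replicate x false
  lookup-vsetᴸ (y ∷ q) x = trans (lookup-∪ ⁅ y ⁆ (vsetᴸ q) x) (cong₂ _∨_ (lookup-⁅⁆ y x) (lookup-vsetᴸ q x))

  subsetEqᵇ⇒≡ : ∀ {n} (S T : Subset n) → subsetEqᵇ S T ≡ true → S ≡ T
  subsetEqᵇ⇒≡ S T e = toWitness (Equivalence.from T-≡ e)

  subsetEqᵇ-refl : ∀ {n} (S : Subset n) → subsetEqᵇ S S ≡ true
  subsetEqᵇ-refl S = Equivalence.to T-≡ (fromWitness refl)

  headOr : ∀ {A : Set} → A → List A → A
  headOr a [] = a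
  headOr a (x ∷ _) = x

  eqList : ∀ {n} → List (Fin n) → List (Fin n) → Bool
  eqList q r = ⌊ LP.≡-dec _≟ᶠ_ q r ⌋

  module WalkCount {n} (G : Graph n) (Gsym : ∀ i j → G i j ≡ G j i) (Gloop : ∀ i → G i i ≡ false)
                (l : ℕ) (girth : Girth≥ G (l + 2)) (l≥1 : 1 ≤ l) where
    open OnGraph G
    open Conv G
    open LargeGirth G Gsym Gloop l girth

    sequences : List (List (Fin n))
    sequences = lists (suc l)

    unique-sequences : Unique sequences
    unique-sequences = unique-allFinLists n (suc l)

    ∈-sequences : ∀ q → length q ≡ suc l → q ∈ sequences
    ∈-sequences q e = subst (λ m → q ∈ lists m) e (∈-allLists ∈-allFin q)

    traces : Subset n → List (Fin n) → Bool
    traces S q = isPathᵇ q ∧ subsetEqᵇ (vsetᴸ q) S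

    isLWalk≡any : ∀ S → isLWalk G l S ≡ any (traces S) sequences
    isLWalk≡any S =
      trans (cong (any (λ vs → isPath G vs ∧ subsetEqᵇ (vset vs) S)) (allVecs≡allVecsOf n (suc l)))
        (trans (cong Data.Bool.ListAction.or
                  (trans (LP.map-cong (λ vs → cong₂ (λ a b → a ∧ subsetEqᵇ b S) (isPath≡isPathᵇ vs) (vset≡vsetᴸ vs)) _)
                         (LP.map-∘ (allVecsOf (L.allFin n) (suc l)))))
               (cong (any (traces S)) (map-toList-allVecsOf (L.allFin n) (suc l))))

    vsetᴸ≡⇒⊆ : ∀ (q r : List (Fin n)) → vsetᴸ q ≡ vsetᴸ r → ∀ v → v ∈ q → v ∈ r
    vsetᴸ≡⇒⊆ q r e v m = memberᵇ⇒∈ v r (trans (sym (lookup-vsetᴸ r v)) (trans (cong (λ s → lookup s v) (sym e))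
                          (trans (lookup-vsetᴸ q v) (∈⇒memberᵇ v q m))))

    ⊆⊇⇒vsetᴸ≡ : ∀ (q r : List (Fin n)) → (∀ v → v ∈ q → v ∈ r) → (∀ v → v ∈ r → v ∈ q) → vsetᴸ q ≡ vsetᴸ r
    ⊆⊇⇒vsetᴸ≡ q r f g = trans (sym (VP.tabulate∘lookup (vsetᴸ q)))
      (trans (VP.tabulate-cong (λ v → trans (lookup-vsetᴸ q v) (trans (bool-ext (λ e → ∈⇒memberᵇ v r (f v (memberᵇ⇒∈ v q e)))
                                                                           (λ e → ∈⇒memberᵇ v q (g v (memberᵇ⇒∈ v r e))))
                                                               (sym (lookup-vsetᴸ r v)))))
        (VP.tabulate∘lookup (vsetᴸ r)))

    path≢reverse : ∀ q → IsPath q → 2 ≤ length q → q ≢ reverse q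
    path≢reverse (a ∷ []) _ (s≤s ())
    path≢reverse (a ∷ b ∷ r) (u , _) _ e = unique-head u (∈-rev⁻ (b ∷ r) a∈)
      where
      a∈ : a ∈ reverse (b ∷ r)
      a∈ with reverse (b ∷ r) in eq | trans e (LP.unfold-reverse a (b ∷ r))
      ... | []     | _  = ⊥-elim (case trans (sym (LP.length-reverse (b ∷ r))) (cong length eq) of λ ())
      ... | z ∷ zs | e′ = subst (_∈ z ∷ zs) (sym (cong (headOr a) e′)) (here refl)

    eqList⇒≡ : ∀ (q r : List (Fin n)) → eqList q r ≡ true → q ≡ r
    eqList⇒≡ q r e = toWitness (Equivalence.from T-≡ e)

    eqList-refl : ∀ (q : List (Fin n)) → eqList q q ≡ true
    eqList-refl q = Equivalence.to T-≡ (fromWitness refl)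

    #subsetsTraced : ∀ q → countᵇ (λ S → traces S q) (allSubsets n) ≡ iverson (isPathᵇ q)
    #subsetsTraced q with isPathᵇ q
    ... | false = countᵇ-none (λ S → false ∧ subsetEqᵇ (vsetᴸ q) S) (allSubsets n) (λ S _ → refl)
    ... | true = countᵇ-unique (λ S → true ∧ subsetEqᵇ (vsetᴸ q) S) (unique-allSubsets n) (∈-allSubsets (vsetᴸ q)) (subsetEqᵇ-refl (vsetᴸ q))
        (λ S _ e → sym (subsetEqᵇ⇒≡ (vsetᴸ q) S e))

    Σ#traces≡#paths : sumMap (λ S → countᵇ (traces S) sequences) (allSubsets n) ≡ countᵇ isPathᵇ sequences
    Σ#traces≡#paths = trans (sumMap-countᵇ-comm (λ q S → traces S q) sequences (allSubsets n))
                   (trans (sumMap-cong _ (λ q → iverson (isPathᵇ q)) sequences (λ q _ → #subsetsTraced q)) (sumMap-iverson isPathᵇ sequences))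

    #traces-nonwalk : ∀ S → any (traces S) sequences ≡ false → countᵇ (traces S) sequences ≡ 0
    #traces-nonwalk S none = countᵇ-none (traces S) sequences notTraced
      where
      notTraced : ∀ q → q ∈ sequences → traces S q ≡ false
      notTraced q q∈ with traces S q in tr
      ... | false = refl
      ... | true  = ⊥-elim (false≢true (trans (sym none) (any-true⁺ (traces S) q∈ tr)))

    -- S is traced exactly by q₀ and its reverse, as girth > l + 1 pins a path down by its vertex set.
    #traces-walk : ∀ S q₀ → q₀ ∈ sequences → traces S q₀ ≡ true → countᵇ (traces S) sequences ≡ 2
    #traces-walk S q₀ q₀∈ tr₀ =
      trans (countᵇ-cong (traces S) (λ q → eqList q q₀ ∨ eqList q (reverse q₀)) sequences (λ q q∈ → bool-ext (fwd q q∈) (bwd q)))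
        (trans (countᵇ-∨-disjoint (λ q → eqList q q₀) (λ q → eqList q (reverse q₀)) sequences
                 (λ q _ a b → path≢reverse q₀ P₀ 2≤length (trans (sym (eqList⇒≡ q q₀ a)) (eqList⇒≡ q (reverse q₀) b))))
          (cong₂ _+_ (countᵇ-unique (λ q → eqList q q₀) unique-sequences q₀∈ (eqList-refl q₀) (λ q _ a → eqList⇒≡ q q₀ a))
                     (countᵇ-unique (λ q → eqList q (reverse q₀)) unique-sequences
                        (∈-sequences (reverse q₀) (trans (LP.length-reverse q₀) length≡)) (eqList-refl (reverse q₀))
                        (λ q _ a → eqList⇒≡ q (reverse q₀) a))))
      where
      P₀ : IsPath q₀
      P₀ = isPathᵇ⇒IsPath q₀ (proj₁ (∧-true⁻ (isPathᵇ q₀) tr₀))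
      vset₀ : vsetᴸ q₀ ≡ S
      vset₀ = subsetEqᵇ⇒≡ (vsetᴸ q₀) S (proj₂ (∧-true⁻ (isPathᵇ q₀) tr₀))
      length≡ : length q₀ ≡ suc l
      length≡ = ∈-lists⇒length (suc l) q₀ q₀∈
      2≤length : 2 ≤ length q₀
      2≤length = subst (2 ≤_) (sym length≡) (s≤s l≥1)
      fwd : ∀ q → q ∈ sequences → traces S q ≡ true → (eqList q q₀ ∨ eqList q (reverse q₀)) ≡ true
      fwd q q∈ tr with sameVertices⇒≡-or-reverse q₀ q P₀ (isPathᵇ⇒IsPath q (proj₁ (∧-true⁻ (isPathᵇ q) tr)))
                         (trans length≡ (sym (∈-lists⇒length (suc l) q q∈))) (≤-reflexive (trans length≡ (+-comm 1 l)))
                         (vsetᴸ≡⇒⊆ q₀ q (trans vset₀ (sym vsetq))) (vsetᴸ≡⇒⊆ q q₀ (trans vsetq (sym vset₀)))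
        where
        vsetq : vsetᴸ q ≡ S
        vsetq = subsetEqᵇ⇒≡ (vsetᴸ q) S (proj₂ (∧-true⁻ (isPathᵇ q) tr))
      ... | inj₁ refl rewrite eqList-refl q = refl
      ... | inj₂ refl rewrite eqList-refl (reverse q₀) = ∨-zeroʳ (eqList (reverse q₀) q₀)
      bwd : ∀ q → (eqList q q₀ ∨ eqList q (reverse q₀)) ≡ true → traces S q ≡ true
      bwd q e with ∨-true⁻ e
      ... | inj₁ a rewrite eqList⇒≡ q q₀ a = tr₀
      ... | inj₂ b rewrite eqList⇒≡ q (reverse q₀) b =
        cong₂ _∧_ (IsPath⇒isPathᵇ (reverse q₀) (IsPath-reverse q₀ P₀))
          (subst (λ z → subsetEqᵇ z S ≡ true)
                 (sym (trans (⊆⊇⇒vsetᴸ≡ (reverse q₀) q₀ (λ v m → ∈-rev⁻ q₀ m) (λ v m → ∈-rev⁺ q₀ m)) vset₀))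
                 (subsetEqᵇ-refl S))

    #traces : ∀ S → countᵇ (traces S) sequences ≡ 2 * iverson (isLWalk G l S)
    #traces S rewrite isLWalk≡any S with any (traces S) sequences in found
    ... | false = #traces-nonwalk S found
    ... | true  = let q₀ , q₀∈ , tr₀ = any-true⁻ (traces S) sequences found in #traces-walk S q₀ q₀∈ tr₀

    2*numWalks≡#paths : 2 * numWalks G l ≡ countᵇ isPathᵇ sequences
    2*numWalks≡#paths = trans (cong (2 *_) (length-filterᵇ (isLWalk G l) (allSubsets n)))
             (trans (sym (trans (sumMap-*ˡ 2 (λ S → iverson (isLWalk G l S)) (allSubsets n)) (cong (2 *_) (sumMap-iverson (isLWalk G l) (allSubsets n)))))
               (trans (sym (sumMap-cong _ _ (allSubsets n) (λ S _ → #traces S))) Σ#traces≡#paths))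

    module CountWalks (d : ℕ) (reg : Regular d G) where
      open RegularCount d reg

      #paths : countᵇ isPathᵇ sequences ≡ n * (d * (d ∸ 1) ^ (l ∸ 1))
      #paths = trans (countᵇ-concatMap isPathᵇ (λ v → map (v ∷_) (lists l)) (L.allFin n))
        (trans (sumMap-cong _ (λ _ → d * (d ∸ 1) ^ (l ∸ 1)) (L.allFin n) (λ v _ → per v))
          (trans (sumMap-const _ (L.allFin n)) (cong (_* (d * (d ∸ 1) ^ (l ∸ 1))) (LP.length-tabulate {n = n} (λ i → i)))))
        where
        C2' : ∀ m → m ≡ l → 1 ≤ m → ∀ v → #extensions m v (λ _ → true) ≡ d * (d ∸ 1) ^ (m ∸ 1)
        C2' (suc l') e _ v = #extensions-free l' (≤-reflexive e) v
        per : ∀ v → countᵇ isPathᵇ (map (v ∷_) (lists l)) ≡ d * (d ∸ 1) ^ (l ∸ 1)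
        per v = trans (countᵇ-map isPathᵇ (v ∷_) (lists l))
                  (trans (countᵇ-cong _ (λ vs → isPathᵇ (v ∷ vs) ∧ headSatisfies (λ _ → true) vs) (lists l) (λ vs _ → hk vs)) (C2' l refl l≥1 v))
          where
          hk : ∀ vs → isPathᵇ (v ∷ vs) ≡ (isPathᵇ (v ∷ vs) ∧ headSatisfies (λ _ → true) vs)
          hk vs = sym (trans (cong (isPathᵇ (v ∷ vs) ∧_) (headSatisfies-true vs)) (∧-identityʳ _))

      numWalks≡ : numWalks G l ≡ (n * d * (d ∸ 1) ^ (l ∸ 1)) / 2
      numWalks≡ = sym (trans (cong (_/ 2) (trans (*-assoc n d _) (trans (sym #paths) (trans (sym 2*numWalks≡#paths) (*-comm 2 (numWalks G l))))))
                    (m*n/n≡m (numWalks G l) 2))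

module Degree where

  open import Data.Bool using (Bool; true; false; _∧_; _∨_; not)
  open import Data.Bool.Properties using (∧-identityʳ)
  open import Data.Nat
  open import Data.Nat.Properties
  open import Data.Nat.Tactic.RingSolver using (solve-∀)
  open import Data.Fin using (Fin; zero; suc)
  open import Data.Fin.Subset using (Subset; _∩_)
  open import Data.Vec using (Vec; lookup)
  import Data.Vec as Vec
  import Data.Vec.Properties as VP
  open import Data.List using (List; []; _∷_; length; _++_; reverse; map; concatMap; filterᵇ; take; drop)
  import Data.List as L
  import Data.List.Properties as LP
  open import Data.Bool.ListAction using (any)
  open import Data.List.Membership.Propositional using (_∈_)
  open import Data.List.Membership.Propositional.Properties using (∈-allFin; ∈-map⁺; ∈-lookup; ∈-upTo⁺; ∈-upTo⁻)
  open import Data.List.Relation.Unary.Any using (here; there)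
  open import Data.Product using (∃; ∃₂; proj₁; proj₂)
  open import Data.Sum using (inj₁; inj₂)
  open import Data.Empty using (⊥-elim)
  open import Relation.Binary.PropositionalEquality
  open Counting
  open Enumeration
  open FinCounting
  open Unfolding
  open Paths
  open Walks

  atPosition : ∀ {n} → ℕ → Fin n → List (Fin n) → Bool
  atPosition _ v [] = false
  atPosition zero v (x ∷ q) = eqFin x v
  atPosition (suc t) v (x ∷ q) = atPosition t v q

  atPosition⇒split : ∀ {n} t (v : Fin n) q → atPosition t v q ≡ true → (q ≡ take t q ++ v ∷ drop (suc t) q) × length (take t q) ≡ t
  atPosition⇒split zero v (x ∷ q) e rewrite eqFin⇒≡ {i = x} {j = v} e = refl , refl
  atPosition⇒split (suc t) v (x ∷ q) e = let a , b = atPosition⇒split t v q e in cong (x ∷_) a , cong suc b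

  ∈⇒atPosition : ∀ {n} (v : Fin n) q → v ∈ q → ∃ λ t → t < length q × atPosition t v q ≡ true
  ∈⇒atPosition v (x ∷ q) (here refl) = 0 , s≤s z≤n , eqFin-refl v
  ∈⇒atPosition v (x ∷ q) (there m) = let t , lt , e = ∈⇒atPosition v q m in suc t , s≤s lt , e

  countᵇ-any≤ : ∀ {A B : Set} (P : B → A → Bool) (ts : List B) xs →
    countᵇ (λ x → any (λ t → P t x) ts) xs ≤ sumMap (λ t → countᵇ (P t) xs) ts
  countᵇ-any≤ P [] xs = ≤-reflexive (countᵇ-none _ xs (λ _ _ → refl))
  countᵇ-any≤ P (t ∷ ts) xs = ≤-trans (countᵇ-∨-≤ (P t) (λ x → any (λ t → P t x) ts) xs) (+-monoʳ-≤ (countᵇ (P t) xs) (countᵇ-any≤ P ts xs))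

  notEqHead : ∀ {n} → List (Fin n) → Fin n → Bool
  notEqHead [] = λ _ → true
  notEqHead (x ∷ _) y = not (eqFin y x)

  firstOr : ∀ {A : Set} → (A → Bool) → List A → A → A
  firstOr p [] d = d
  firstOr p (x ∷ xs) d with p x
  ... | true = x
  ... | false = firstOr p xs d

  firstOr-satisfies : ∀ {A : Set} (p : A → Bool) xs d → any p xs ≡ true → p (firstOr p xs d) ≡ true × firstOr p xs d ∈ xs
  firstOr-satisfies p (x ∷ xs) d e with p x in px
  ... | true = px , here refl
  ... | false = let a , b = firstOr-satisfies p xs d e in a , there b

  nonemptyᵇ-true⁻ : ∀ {m} (S : Subset m) → nonemptyᵇ S ≡ true → ∃ λ v → lookup S v ≡ true
  nonemptyᵇ-true⁻ (true Vec.∷ S) e = zero , refl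
  nonemptyᵇ-true⁻ (false Vec.∷ S) e = let v , p = nonemptyᵇ-true⁻ S e in suc v , p

  countFin-lookup : ∀ {A : Set} (f : A → Bool) xs → countFin (λ j → f (L.lookup xs j)) ≡ countᵇ f xs
  countFin-lookup f [] = refl
  countFin-lookup f (x ∷ xs) = cong (iverson (f x) +_) (countFin-lookup f xs)

  module DegreeBound {n} (G : Graph n) (Gsym : ∀ i j → G i j ≡ G j i) (Gloop : ∀ i → G i i ≡ false)
                (l : ℕ) (girth : Girth≥ G (l + 2)) (l≥1 : 1 ≤ l) (d : ℕ) (reg : Regular d G) where
    open OnGraph G
    open LargeGirth G Gsym Gloop l girth
    open WalkCount G Gsym Gloop l girth l≥1
    open RegularCount d reg

    pathsFromVertex : ℕ
    pathsFromVertex = d * (d ∸ 1) ^ (l ∸ 1)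

    -- A path with v at position t is determined by its two arms: the reversed first t vertices and the last
    -- l - t vertices, both paths starting at v and leaving it in different directions.
    module ThroughVertex (t : ℕ) (t≤l : t ≤ l) (v : Fin n) where
      leftArms : List (List (Fin n))
      leftArms = filterᵇ (λ a → isPathᵇ (v ∷ a)) (lists t)

      rightArms : List (Fin n) → List (List (Fin n))
      rightArms a = filterᵇ (λ b → isPathᵇ (v ∷ b) ∧ headSatisfies (notEqHead a) b) (lists (l ∸ t))

      armPairs : List (List (Fin n) × List (Fin n))
      armPairs = concatMap (λ a → map (a ,_) (rightArms a)) leftArms

      splitAtVertex : List (Fin n) → List (Fin n) × List (Fin n)
      splitAtVertex q = (reverse (take t q) , drop (suc t) q)

      pathsThrough : List (List (Fin n))
      pathsThrough = filterᵇ (λ q → isPathᵇ q ∧ atPosition t v q) sequences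

      trivialHead : ∀ vs → isPathᵇ (v ∷ vs) ≡ (isPathᵇ (v ∷ vs) ∧ headSatisfies (λ _ → true) vs)
      trivialHead vs = sym (trans (cong (isPathᵇ (v ∷ vs) ∧_) (headSatisfies-true vs)) (∧-identityʳ _))

      length-leftArms : length leftArms ≡ #extensions t v (λ _ → true)
      length-leftArms = trans (length-filterᵇ _ (lists t)) (countᵇ-cong _ _ (lists t) (λ a _ → trivialHead a))

      length-armPairs : length armPairs ≡ sumMap (λ a → #extensions (l ∸ t) v (notEqHead a)) leftArms
      length-armPairs = trans (length-concatMap _ leftArms)
        (sumMap-cong _ _ leftArms (λ a _ → trans (LP.length-map (a ,_) (rightArms a)) (length-filterᵇ _ (lists (l ∸ t)))))

      length-armPairs≡ : length armPairs ≡ pathsFromVertex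
      length-armPairs≡ = trans length-armPairs (armPairsByLeftArm t refl t≤l)
        where
        armPairsByLeftArm : ∀ t' → t' ≡ t → t ≤ l → sumMap (λ a → #extensions (l ∸ t) v (notEqHead a)) leftArms ≡ pathsFromVertex
        armPairsByLeftArm zero refl _ = noLeftArm l refl l≥1
          where
          noLeftArm : ∀ m → m ≡ l → 1 ≤ m → #extensions l v (λ _ → true) + 0 ≡ pathsFromVertex
          noLeftArm (suc m) e _ = trans (+-identityʳ _) (subst (λ z → #extensions z v (λ _ → true) ≡ d * (d ∸ 1) ^ (z ∸ 1)) e (#extensions-free m (≤-reflexive e) v))
        armPairsByLeftArm (suc t') refl le =
          trans (sumMap-cong _ (λ _ → (d ∸ 1) ^ (l ∸ t)) leftArms (λ a m → rightArmCount a m))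
            (trans (sumMap-const _ leftArms)
              (trans (cong (_* (d ∸ 1) ^ (l ∸ t)) (trans length-leftArms (#extensions-free t' le v)))
                (trans (*-assoc d ((d ∸ 1) ^ t') _)
                  (cong (d *_) (trans (sym (^-distribˡ-+-* (d ∸ 1) t' (l ∸ t))) (cong ((d ∸ 1) ^_) exponents))))))
          where
          rightArmCount : ∀ a → a ∈ leftArms → #extensions (l ∸ t) v (notEqHead a) ≡ (d ∸ 1) ^ (l ∸ t)
          rightArmCount a m with ∈-filterᵇ⁻ _ (lists t) m
          ... | am , pa with a | ∈-lists⇒length t a am
          ...   | x ∷ a' | _ = #extensions-avoiding (l ∸ t) (m∸n≤m l t) v x (proj₁ (proj₂ (isPathᵇ⇒IsPath (v ∷ x ∷ a') pa)))
          exponents : t' + (l ∸ suc t') ≡ l ∸ 1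
          exponents = trans (cong (t' +_) (sym (∸-+-assoc l 1 t'))) (m+[n∸m]≡n (s≤⇒≤∸1 le))
            where
            s≤⇒≤∸1 : suc t' ≤ l → t' ≤ l ∸ 1
            s≤⇒≤∸1 (s≤s h) = h

      module _ (q : List (Fin n)) (m : q ∈ pathsThrough) where
        qm = ∈-filterᵇ⁻ (λ q → isPathᵇ q ∧ atPosition t v q) sequences m
        q∈ : q ∈ sequences
        q∈ = proj₁ qm
        q-path : isPathᵇ q ≡ true
        q-path = proj₁ (∧-true⁻ (isPathᵇ q) (proj₂ qm))
        q-split = atPosition⇒split t v q (proj₂ (∧-true⁻ (isPathᵇ q) (proj₂ qm)))
        pre = take t q
        post = drop (suc t) q
        qeq : q ≡ pre ++ v ∷ post
        qeq = proj₁ q-split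
        lpre : length pre ≡ t
        lpre = proj₂ q-split
        P : IsPath (pre ++ v ∷ post)
        P = subst IsPath qeq (isPathᵇ⇒IsPath q q-path)
        lpost : length post ≡ l ∸ t
        lpost = trans (sym (m+n∸m≡n t (length post)))
                  (cong (_∸ t) (suc-injective (trans (sym (trans (cong length qeq) (trans (LP.length-++ pre) (trans (cong (_+ suc (length post)) lpre) (+-suc t (length post))))))
                                                   (∈-lists⇒length (suc l) q q∈))))
        revPre : IsPath (v ∷ reverse pre)
        revPre = subst IsPath (LP.reverse-++ pre (v ∷ []))
                   (IsPath-reverse (pre ++ v ∷ []) (IsPath-++ˡ (pre ++ v ∷ []) post (subst IsPath (sym (LP.++-assoc pre (v ∷ []) post)) P)))
        hdOK : headSatisfies (notEqHead (reverse pre)) post ≡ true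
        hdOK with post in po | reverse pre in rp
        ... | [] | _ = refl
        ... | y ∷ _ | [] = refl
        ... | y ∷ _ | x ∷ _ with eqFin-cases y x
        ...   | inj₂ (ne , e) rewrite e = refl
        ...   | inj₁ (refl , e) = ⊥-elim (unique-++-disjoint pre (v ∷ post) (proj₁ P)
                                    (∈-rev⁻ pre (subst (y ∈_) (sym rp) (here refl)))
                                    (there (subst (y ∈_) (sym po) (here refl))))
        inPr : splitAtVertex q ∈ armPairs
        inPr = ∈-concatMap⁺ (λ a → map (a ,_) (rightArms a))
                 (∈-filterᵇ⁺ _ (subst (λ z → reverse pre ∈ lists z) (trans (LP.length-reverse pre) lpre)
                                           (∈-allLists ∈-allFin (reverse pre)))
                                      (IsPath⇒isPathᵇ (v ∷ reverse pre) revPre))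
                 (∈-map⁺ (reverse pre ,_)
                   (∈-filterᵇ⁺ _ (subst (λ z → post ∈ lists z) lpost (∈-allLists ∈-allFin post))
                     (cong₂ _∧_ (IsPath⇒isPathᵇ (v ∷ post) (IsPath-++ʳ pre (v ∷ post) P)) hdOK)))

      splitAtVertex-injective : ∀ q1 q2 → q1 ∈ pathsThrough → q2 ∈ pathsThrough → splitAtVertex q1 ≡ splitAtVertex q2 → q1 ≡ q2
      splitAtVertex-injective q1 q2 m1 m2 e =
        trans (qeq q1 m1) (trans (cong₂ (λ a b → a ++ v ∷ b) preEq (cong proj₂ e)) (sym (qeq q2 m2)))
        where
        preEq : take t q1 ≡ take t q2
        preEq = trans (sym (LP.reverse-involutive (take t q1)))
                  (trans (cong reverse (cong proj₁ e)) (LP.reverse-involutive (take t q2)))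

      #pathsThrough≤ : countᵇ (λ q → isPathᵇ q ∧ atPosition t v q) sequences ≤ pathsFromVertex
      #pathsThrough≤ = ≤-trans (≤-reflexive (sym (length-filterᵇ _ sequences)))
        (≤-trans (injective⇒length≤ splitAtVertex (unique-filterᵇ _ unique-sequences) splitAtVertex-injective (λ q m → inPr q m)) (≤-reflexive length-armPairs≡))

    somePath : Subset n → List (Fin n)
    somePath S = firstOr (traces S) sequences []

    somePath-traces : ∀ S → isLWalk G l S ≡ true → traces S (somePath S) ≡ true × somePath S ∈ sequences
    somePath-traces S e = firstOr-satisfies (traces S) sequences [] (trans (sym (isLWalk≡any S)) e)

    vsetᴸ-somePath : ∀ S → isLWalk G l S ≡ true → vsetᴸ (somePath S) ≡ S
    vsetᴸ-somePath S e = subsetEqᵇ⇒≡ _ S (proj₂ (∧-true⁻ (isPathᵇ (somePath S)) (proj₁ (somePath-traces S e))))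

    walks : List (Subset n)
    walks = lWalks G l

    meets : Subset n → Subset n → Bool
    meets W S = nonemptyᵇ (W ∩ S)

    #meeting≤#pathsMeeting : ∀ W → countᵇ (meets W) walks ≤ countᵇ (λ q → isPathᵇ q ∧ meets W (vsetᴸ q)) sequences
    #meeting≤#pathsMeeting W = ≤-trans (≤-reflexive (sym (length-filterᵇ (meets W) walks)))
      (≤-trans (injective⇒length≤ somePath (unique-filterᵇ (meets W) (unique-filterᵇ (isLWalk G l) (unique-allSubsets n))) inj mem)
               (≤-reflexive (length-filterᵇ _ sequences)))
      where
      walkOf : ∀ S → S ∈ filterᵇ (meets W) walks → isLWalk G l S ≡ true × meets W S ≡ true
      walkOf S m = let a , b = ∈-filterᵇ⁻ (meets W) walks m in proj₂ (∈-filterᵇ⁻ (isLWalk G l) (allSubsets n) a) , b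
      inj : ∀ S T → S ∈ filterᵇ (meets W) walks → T ∈ filterᵇ (meets W) walks → somePath S ≡ somePath T → S ≡ T
      inj S T mS mT e = trans (sym (vsetᴸ-somePath S (proj₁ (walkOf S mS)))) (trans (cong vsetᴸ e) (vsetᴸ-somePath T (proj₁ (walkOf T mT))))
      mem : ∀ S → S ∈ filterᵇ (meets W) walks → somePath S ∈ filterᵇ (λ q → isPathᵇ q ∧ meets W (vsetᴸ q)) sequences
      mem S m = let w , mt = walkOf S m
                    ok , inL = somePath-traces S w
                in ∈-filterᵇ⁺ _ inL (cong₂ _∧_ (proj₁ (∧-true⁻ (isPathᵇ (somePath S)) ok)) (trans (cong (meets W) (vsetᴸ-somePath S w)) mt))

    #pathsThroughVertex≤ : ∀ v → countᵇ (λ q → isPathᵇ q ∧ memberᵇ v q) sequences ≤ suc l * pathsFromVertex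
    #pathsThroughVertex≤ v = ≤-trans (countᵇ-mono _ (λ q → any (λ t → isPathᵇ q ∧ atPosition t v q) (L.upTo (suc l))) sequences mono)
               (≤-trans (countᵇ-any≤ (λ t q → isPathᵇ q ∧ atPosition t v q) (L.upTo (suc l)) sequences)
                 (≤-trans (sumMap-mono _ (λ _ → pathsFromVertex) (L.upTo (suc l)) (λ t m → ThroughVertex.#pathsThrough≤ t (upTo≤ m) v))
                   (≤-reflexive (trans (sumMap-const pathsFromVertex (L.upTo (suc l))) (cong (_* pathsFromVertex) (LP.length-upTo (suc l)))))))
      where
      upTo≤ : ∀ {t} → t ∈ L.upTo (suc l) → t ≤ l
      upTo≤ m = s≤s⁻¹ (∈-upTo⁻ m)
      mono : ∀ q → q ∈ sequences → (isPathᵇ q ∧ memberᵇ v q) ≡ true → any (λ t → isPathᵇ q ∧ atPosition t v q) (L.upTo (suc l)) ≡ true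
      mono q qm e = let p , mv = ∧-true⁻ (isPathᵇ q) e
                        t , lt , at = ∈⇒atPosition v q (memberᵇ⇒∈ v q mv)
                    in any-true⁺ _
                         (∈-upTo⁺ (subst (t <_) (∈-lists⇒length (suc l) q qm) lt))
                         (cong₂ _∧_ p at)

    -- A walk meeting W is traced by a path passing through one of the l + 1 vertices of W at one of l + 1 positions.
    #walksMeeting≤ : ∀ W → isLWalk G l W ≡ true → countᵇ (meets W) walks ≤ suc l * (suc l * pathsFromVertex)
    #walksMeeting≤ W w = ≤-trans (#meeting≤#pathsMeeting W)
      (≤-trans (countᵇ-mono _ (λ q → any (λ v → isPathᵇ q ∧ memberᵇ v q) qi) sequences mono)
        (≤-trans (countᵇ-any≤ (λ v q → isPathᵇ q ∧ memberᵇ v q) qi sequences)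
          (≤-trans (sumMap-mono _ (λ _ → suc l * pathsFromVertex) qi (λ v _ → #pathsThroughVertex≤ v))
            (≤-reflexive (trans (sumMap-const _ qi) (cong (_* (suc l * pathsFromVertex)) lqi))))))
      where
      qi = somePath W
      ok = somePath-traces W w
      vs = vsetᴸ-somePath W w
      lqi : length qi ≡ suc l
      lqi = ∈-lists⇒length (suc l) qi (proj₂ ok)
      mono : ∀ q → q ∈ sequences → (isPathᵇ q ∧ meets W (vsetᴸ q)) ≡ true → any (λ v → isPathᵇ q ∧ memberᵇ v q) qi ≡ true
      mono q _ e = let p , ne = ∧-true⁻ (isPathᵇ q) e
                       v , lv = nonemptyᵇ-true⁻ (W ∩ vsetᴸ q) ne
                       a , b = ∧-true⁻ (lookup W v) (trans (sym (VP.lookup-zipWith _∧_ v W (vsetᴸ q))) lv)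
                       vinqi : v ∈ qi
                       vinqi = memberᵇ⇒∈ v qi (trans (sym (lookup-vsetᴸ qi v)) (trans (cong (λ z → lookup z v) vs) a))
                   in any-true⁺ _ vinqi (cong₂ _∧_ p (trans (sym (lookup-vsetᴸ q v)) b))

    degree-interference≤ : ∀ i → degree (interference G l) i ≤ suc l * (suc l * pathsFromVertex)
    degree-interference≤ i = ≤-trans (≤-reflexive (degree≡countFin (interference G l) i))
      (≤-trans (countFin-mono _ (λ j → meets Wi (L.lookup walks j)) (λ j e → proj₂ (∧-true⁻ (not (eqFin i j)) e)))
        (≤-trans (≤-reflexive (countFin-lookup (meets Wi) walks)) (#walksMeeting≤ Wi wi)))
      where
      Wi = L.lookup walks i
      wi : isLWalk G l Wi ≡ true
      wi = proj₂ (∈-filterᵇ⁻ (isLWalk G l) (allSubsets n) (∈-lookup i))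

    maxDegree-interference≤ : maxDegree (interference G l) ≤ (l + 1) ^ 2 * d * (d ∸ 1) ^ (l ∸ 1)
    maxDegree-interference≤ =
      maxDegree≤ (interference G l) _ (λ i → ≤-trans (degree-interference≤ i) (≤-reflexive (square l d ((d ∸ 1) ^ (l ∸ 1)))))
      where
      square : ∀ l d c → suc l * (suc l * (d * c)) ≡ (l + 1) * ((l + 1) * 1) * d * c
      square = solve-∀

interference-loopless : ∀ {n} (G : Graph n) l i → interference G l i i ≡ false
interference-loopless G l i rewrite FinCounting.eqFin-refl i = refl

mainTheorem9 : ∀ (n d l : ℕ) (G : Graph n) →
    IsSimple G → Regular d G → 1 ≤ l → Girth≥ G (l + 2) →
    (numWalks G l ≡ (n * d * (d ∸ 1) ^ (l ∸ 1)) / 2)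
    × (maxDegree (interference G l) ≤ (l + 1) ^ 2 * d * (d ∸ 1) ^ (l ∸ 1))
    × (∀ (k : ℕ) → numRootedTrees (interference G l) k
         ≤ 4 ^ k * numWalks G l * maxDegree (interference G l) ^ (k ∸ 1))
mainTheorem9 n d l G (symmetric , loopless) regular l≥1 girth =
  Walks.WalkCount.CountWalks.numWalks≡ G symmetric loopless l girth l≥1 d regular ,
  Degree.DegreeBound.maxDegree-interference≤ G symmetric loopless l girth l≥1 d regular ,
  TreeCounting.numRootedTrees≤ (interference G l) (interference-loopless G l)
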